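{- Let $m\ge1$, $n'\ge0$, $n''\ge0$ be integers with $n''\ne1$, and suppose there exist an even integer $\Gamma\ge0$ and an even integer $\Delta\ge2$ such that $2m+n'+n''=(2^{\Gamma+2\Delta}-1)/3$, $3n'+n''=2^{\Gamma+\Delta}-1$ and $n''\le 2^{\Delta}-1$. Then there is a $1$-perfect code in $\mathbb{Z}_4^{2m}\times\mathbb{Z}_2^{2n'}\times\mathbb{Z}_4^{n''}$ with the $D(m,n'+n'')$-metric.
   Context: The $D(m,n'+n'')$-metric on $\mathbb{Z}_4^{2m}\times\mathbb{Z}_2^{2n'}\times\mathbb{Z}_4^{n''}$ is the graph distance in the Cartesian product of $m$ copies of the Cayley graph of $\mathbb{Z}_4^2$ with generators $\{01,30,33,03,10,11\}$ (Shrikhande graph, on consecutive coordinate pairs of the first part), $n'$ copies of the Cayley graph of $\mathbb{Z}_2^2$ with generators $\{01,10,11\}$ (on consecutive coordinate pairs of the second part), and $n''$ copies of the Cayley graph of $\mathbb{Z}_4$ with generators $\{1,2,3\}$ (one per coordinate of the third part); this graph is the Doob graph $D(m,n'+n'')$. A $1$-perfect code is a vertex set whose radius-$1$ balls partition the vertex set. -}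

module Defs where

open import Data.Nat using (ℕ; _+_; _∸_)
open import Data.Nat.DivMod using (_mod_)
open import Data.Fin using (Fin; toℕ)
open import Data.Fin.Patterns using (0F; 1F; 2F; 3F)
open import Data.Product using (_×_; _,_; Σ)
open import Data.Sum using (_⊎_)
open import Data.Vec using (Vec; []; _∷_)
open import Data.List using (List; []; _∷_)
open import Data.List.Membership.Propositional using (_∈_)
open import Data.Empty using (⊥)
open import Data.Bool using (Bool; true)
open import Relation.Binary.PropositionalEquality using (_≡_)

sub4 : Fin 4 → Fin 4 → Fin 4
sub4 a b = (4 + toℕ a ∸ toℕ b) mod 4

sub2 : Fin 2 → Fin 2 → Fin 2
sub2 a b = (2 + toℕ a ∸ toℕ b) mod 2

shrikhandeGens : List (Fin 4 × Fin 4)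
shrikhandeGens = (0F , 1F) ∷ (3F , 0F) ∷ (3F , 3F) ∷ (0F , 3F) ∷ (1F , 0F) ∷ (1F , 1F) ∷ []

ShrAdj : Fin 4 × Fin 4 → Fin 4 × Fin 4 → Set
ShrAdj (x₁ , x₂) (y₁ , y₂) = (sub4 y₁ x₁ , sub4 y₂ x₂) ∈ shrikhandeGens

k4Gens : List (Fin 2 × Fin 2)
k4Gens = (0F , 1F) ∷ (1F , 0F) ∷ (1F , 1F) ∷ []

K4Adj : Fin 2 × Fin 2 → Fin 2 × Fin 2 → Set
K4Adj (x₁ , x₂) (y₁ , y₂) = (sub2 y₁ x₁ , sub2 y₂ x₂) ∈ k4Gens

-- Cayley graph of ℤ₄ with generators {1,2,3} (complete graph K₄).
z4Gens : List (Fin 4)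
z4Gens = 1F ∷ 2F ∷ 3F ∷ []

Z4Adj : Fin 4 → Fin 4 → Set
Z4Adj x y = sub4 y x ∈ z4Gens

ProdAdj : {A : Set} → (A → A → Set) → {n : ℕ} → Vec A n → Vec A n → Set
ProdAdj R [] [] = ⊥
ProdAdj R (x ∷ xs) (y ∷ ys) = (R x y × xs ≡ ys) ⊎ (x ≡ y × ProdAdj R xs ys)

-- Vertices of the Doob graph D(m, n'+n''):
-- ℤ₄^{2m} × ℤ₂^{2n'} × ℤ₄^{n''}, grouped into consecutive coordinate pairs
-- for the first two parts.
DoobVertex : ℕ → ℕ → ℕ → Set
DoobVertex m n' n'' = Vec (Fin 4 × Fin 4) m × Vec (Fin 2 × Fin 2) n' × Vec (Fin 4) n''

DoobAdj : {m n' n'' : ℕ} → DoobVertex m n' n'' → DoobVertex m n' n'' → Set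
DoobAdj (a , b , c) (a' , b' , c') =
    (ProdAdj ShrAdj a a' × b ≡ b' × c ≡ c')
  ⊎ (a ≡ a' × ProdAdj K4Adj b b' × c ≡ c')
  ⊎ (a ≡ a' × b ≡ b' × ProdAdj Z4Adj c c')

DoobDist≤1 : {m n' n'' : ℕ} → DoobVertex m n' n'' → DoobVertex m n' n'' → Set
DoobDist≤1 x y = x ≡ y ⊎ DoobAdj x y

IsOnePerfectCode : (m n' n'' : ℕ) → (DoobVertex m n' n'' → Bool) → Set
IsOnePerfectCode m n' n'' C =
  ((x : DoobVertex m n' n'') → Σ (DoobVertex m n' n'') λ c → C c ≡ true × DoobDist≤1 c x)
  × ((x c c' : DoobVertex m n' n'') → C c ≡ true → C c' ≡ true →
       DoobDist≤1 c x → DoobDist≤1 c' x → c ≡ c')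

OnePerfectCodeExists : (m n' n'' : ℕ) → Set
OnePerfectCodeExists m n' n'' = Σ (DoobVertex m n' n'' → Bool) λ C → IsOnePerfectCode m n' n'' C

module Submission where

-- 1-perfect codes in the Doob graph D(m, n'+n''), built from perfect
-- syndrome tables over the Galois ring R = GR(4,2) and its residue field
-- F = GF(4).  A vertex has Shrikhande coordinates in ℤ₄² ≅ R, K₄
-- coordinates in ℤ₂² ≅ F and ℤ₄ coordinates.  Choosing a column in the
-- R-module Syn d g = F^g × R^d for every coordinate, a vertex gets the
-- syndrome Σ coordinate·column, and one graph step changes it by a single
-- error ± ωⁱ·s, ωⁱ·k or ε·z.  When every syndrome comes from exactly one
-- error (a perfect table), the vertices of syndrome 0 form a 1-perfect code.
--
-- Trading j
-- pairs for 3j ℤ₄-columns gives n'' = 3j.  The hypotheses of corollary3,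
-- with Γ = 2g and Δ = 2d, are exactly the counting identities fitting
-- m, n', n'' to a table.

open import Defs
open import Data.Nat using (ℕ; _+_; _*_; _^_; _≤_)
open import Data.Nat.Divisibility using (_∣_)
open import Data.Product using (_×_; Σ)
open import Relation.Binary.PropositionalEquality using (_≡_; _≢_)

open import Data.Nat using (zero; suc; _∸_)
open import Data.Nat.DivMod using (_/_; _mod_)
open import Data.Nat.Properties
  using (+-comm; *-comm; +-cancelʳ-≡; +-cancelˡ-≡; *-cancelˡ-≡; *-cancelˡ-≤; +-cancelʳ-≤;
         m≤m+n; m+[n∸m]≡n; *-distribˡ-+; ^-distribˡ-+-*; ^-*-assoc)
open import Data.Nat.Divisibility using (divides)
open import Data.Nat.Tactic.RingSolver using (solve-∀)
open import Data.Fin using (Fin; toℕ) renaming (zero to fzero; suc to fsuc)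
open import Data.Fin.Patterns using (0F; 1F; 2F; 3F)
open import Data.Fin.Properties using (all?; +↔⊎; *↔×; 0↔⊥) renaming (_≟_ to _≟ᶠ_)
open import Data.Bool using (Bool; true; false; not)
open import Data.Bool.Properties using (T-≡)
open import Data.Product using (_,_; proj₁; proj₂; uncurry)
open import Data.Product.Properties using (≡-dec)
open import Data.Product.Function.NonDependent.Propositional using (_×-↔_)
open import Data.Sum using (_⊎_; inj₁; inj₂; [_,_])
open import Data.Sum.Function.Propositional using (_⊎-↔_)
open import Data.Empty using (⊥; ⊥-elim)
open import Data.Vec using (Vec; []; _∷_; map; zipWith; replicate; updateAt)
import Data.Vec.Properties as Vec
open import Data.List using (List)
open import Data.List.Membership.Propositional using (_∈_)
open import Data.List.Relation.Unary.Any using (here; there)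
open import Function using (_∘_; Equivalence)
open import Function.Bundles using (_↔_; Inverse; mk↔ₛ′)
open import Function.Properties.Inverse using (↔-refl; ↔-sym; ↔-trans)
open import Relation.Nullary using (Dec; yes; no)
open import Relation.Nullary.Decidable using (from-yes; _×-dec_; map′; _→-dec_; isYes; toWitness; fromWitness)
open import Relation.Binary using (DecidableEquality)
open import Relation.Binary.PropositionalEquality using (refl; cong; cong₂; sym; trans; subst; subst₂)
open Relation.Binary.PropositionalEquality.≡-Reasoning

-- R is the Galois ring GR(4,2) = ℤ₄[ω]/(ω² + ω + 1), stored
-- as pairs (a , b) ↦ a + bω, and F = GF(4) = R/2R, stored likewise over
-- ℤ₂.  All identities between finitely many elements of these rings are
-- proved by exhaustive evaluation (`from-yes` on a decided statement).

Z4 Z2 : Set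
Z4 = Fin 4
Z2 = Fin 2

_+₄_ _*₄_ : Z4 → Z4 → Z4
a +₄ b = (toℕ a + toℕ b) mod 4
a *₄ b = (toℕ a * toℕ b) mod 4

-₄_ : Z4 → Z4
-₄ a = sub4 0F a

_+₂_ _*₂_ : Z2 → Z2 → Z2
a +₂ b = (toℕ a + toℕ b) mod 2
a *₂ b = (toℕ a * toℕ b) mod 2

R F : Set
R = Z4 × Z4
F = Z2 × Z2

infixl 6 _+R_ _+F_
infixl 7 _*R_ _*F_
infix 4 _≟R_ _≟F_
infix 9 ω^_ ωF^_

_+R_ _*R_ : R → R → R
(a , b) +R (c , d) = a +₄ c , b +₄ d
(a , b) *R (c , d) = (a *₄ c) +₄ (-₄ (b *₄ d)) , ((a *₄ d) +₄ (b *₄ c)) +₄ (-₄ (b *₄ d))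

-R_ : R → R
-R (a , b) = -₄ a , -₄ b

_+F_ _*F_ : F → F → F
(a , b) +F (c , d) = a +₂ c , b +₂ d
(a , b) *F (c , d) = (a *₂ c) +₂ (b *₂ d) , ((a *₂ d) +₂ (b *₂ c)) +₂ (b *₂ d)

0R 1R 2R : R
0R = 0F , 0F
1R = 1F , 0F
2R = 2F , 0F

0F' 1F' : F
0F' = 0F , 0F
1F' = 1F , 0F

_≟R_ : DecidableEquality R
_≟R_ = ≡-dec _≟ᶠ_ _≟ᶠ_

_≟F_ : DecidableEquality F
_≟F_ = ≡-dec _≟ᶠ_ _≟ᶠ_

∀Fin²? : ∀ {m n} {P : Fin m × Fin n → Set} → ((x : Fin m × Fin n) → Dec (P x)) → Dec ((x : Fin m × Fin n) → P x)
∀Fin²? P? = map′ (λ p → uncurry p) (λ p a b → p (a , b)) (all? λ a → all? λ b → P? (a , b))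

∀R? : {P : R → Set} → ((x : R) → Dec (P x)) → Dec ((x : R) → P x)
∀R? = ∀Fin²?

∀F? : {P : F → Set} → ((x : F) → Dec (P x)) → Dec ((x : F) → P x)
∀F? = ∀Fin²?

∀Bool? : {P : Bool → Set} → ((x : Bool) → Dec (P x)) → Dec ((x : Bool) → P x)
∀Bool? P? = map′ (λ { (t , f) true → t ; (t , f) false → f }) (λ p → p true , p false)
                 (P? true ×-dec P? false)

+R-assoc : ∀ x y z → x +R y +R z ≡ x +R (y +R z)
+R-assoc = from-yes (∀R? λ x → ∀R? λ y → ∀R? λ z → (x +R y +R z) ≟R (x +R (y +R z)))

+R-comm : ∀ x y → x +R y ≡ y +R x
+R-comm = from-yes (∀R? λ x → ∀R? λ y → (x +R y) ≟R (y +R x))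

+R-identityˡ : ∀ x → 0R +R x ≡ x
+R-identityˡ = from-yes (∀R? λ x → (0R +R x) ≟R x)

*R-assoc : ∀ x y z → x *R y *R z ≡ x *R (y *R z)
*R-assoc = from-yes (∀R? λ x → ∀R? λ y → ∀R? λ z → (x *R y *R z) ≟R (x *R (y *R z)))

*R-identityˡ : ∀ x → 1R *R x ≡ x
*R-identityˡ = from-yes (∀R? λ x → (1R *R x) ≟R x)

*R-zeroˡ : ∀ x → 0R *R x ≡ 0R
*R-zeroˡ = from-yes (∀R? λ x → (0R *R x) ≟R 0R)

*R-zeroʳ : ∀ x → x *R 0R ≡ 0R
*R-zeroʳ = from-yes (∀R? λ x → (x *R 0R) ≟R 0R)

*R-distribʳ : ∀ x y z → (x +R y) *R z ≡ x *R z +R y *R z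
*R-distribʳ = from-yes (∀R? λ x → ∀R? λ y → ∀R? λ z → ((x +R y) *R z) ≟R (x *R z +R y *R z))

+F-assoc : ∀ x y z → x +F y +F z ≡ x +F (y +F z)
+F-assoc = from-yes (∀F? λ x → ∀F? λ y → ∀F? λ z → (x +F y +F z) ≟F (x +F (y +F z)))

+F-comm : ∀ x y → x +F y ≡ y +F x
+F-comm = from-yes (∀F? λ x → ∀F? λ y → (x +F y) ≟F (y +F x))

+F-identityˡ : ∀ x → 0F' +F x ≡ x
+F-identityˡ = from-yes (∀F? λ x → (0F' +F x) ≟F x)

*F-assoc : ∀ x y z → x *F y *F z ≡ x *F (y *F z)
*F-assoc = from-yes (∀F? λ x → ∀F? λ y → ∀F? λ z → (x *F y *F z) ≟F (x *F (y *F z)))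

*F-identityˡ : ∀ x → 1F' *F x ≡ x
*F-identityˡ = from-yes (∀F? λ x → (1F' *F x) ≟F x)

*F-identityʳ : ∀ x → x *F 1F' ≡ x
*F-identityʳ = from-yes (∀F? λ x → (x *F 1F') ≟F x)

*F-zeroˡ : ∀ x → 0F' *F x ≡ 0F'
*F-zeroˡ = from-yes (∀F? λ x → (0F' *F x) ≟F 0F')

*F-zeroʳ : ∀ x → x *F 0F' ≡ 0F'
*F-zeroʳ = from-yes (∀F? λ x → (x *F 0F') ≟F 0F')

*F-distribʳ : ∀ x y z → (x +F y) *F z ≡ x *F z +F y *F z
*F-distribʳ = from-yes (∀F? λ x → ∀F? λ y → ∀F? λ z → ((x +F y) *F z) ≟F (x *F z +F y *F z))

-- The 2-adic structure of R: reduction modulo 2 is a ring map onto F,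
-- every x ∈ R is uniquely  lift a + twice b  with a = red x, b = high x,
-- and 2R = image of twice, which is an F-vector space via red.
red : R → F
red (a , b) = (toℕ a) mod 2 , (toℕ b) mod 2

high : R → F
high (a , b) = (toℕ a / 2) mod 2 , (toℕ b / 2) mod 2

lift twice : F → R
lift (a , b) = (toℕ a) mod 4 , (toℕ b) mod 4
twice (a , b) = (2 * toℕ a) mod 4 , (2 * toℕ b) mod 4

red-+ : ∀ x y → red (x +R y) ≡ red x +F red y
red-+ = from-yes (∀R? λ x → ∀R? λ y → red (x +R y) ≟F (red x +F red y))

red-* : ∀ x y → red (x *R y) ≡ red x *F red y
red-* = from-yes (∀R? λ x → ∀R? λ y → red (x *R y) ≟F (red x *F red y))

twice-+ : ∀ f g → twice f +R twice g ≡ twice (f +F g)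
twice-+ = from-yes (∀F? λ f → ∀F? λ g → (twice f +R twice g) ≟R twice (f +F g))

*-twice : ∀ x f → x *R twice f ≡ twice (red x *F f)
*-twice = from-yes (∀R? λ x → ∀F? λ f → (x *R twice f) ≟R twice (red x *F f))

digits : ∀ x → lift (red x) +R twice (high x) ≡ x
digits = from-yes (∀R? λ x → (lift (red x) +R twice (high x)) ≟R x)

red-digits : ∀ a b → red (lift a +R twice b) ≡ a
red-digits = from-yes (∀F? λ a → ∀F? λ b → red (lift a +R twice b) ≟F a)

high-digits : ∀ a b → high (lift a +R twice b) ≡ b
high-digits = from-yes (∀F? λ a → ∀F? λ b → high (lift a +R twice b) ≟F b)

two-*-lift : ∀ a → 2R *R (lift a +R twice 0F') ≡ twice a
two-*-lift = from-yes (∀F? λ a → (2R *R (lift a +R twice 0F')) ≟R twice a)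

twice-injective : ∀ f f' → twice f ≡ twice f' → f ≡ f'
twice-injective = from-yes (∀F? λ f → ∀F? λ f' → (twice f ≟R twice f') →-dec (f ≟F f'))

-- Powers of ω.  The multiplicative group of F is {ω⁰, ω¹, ω²}, and the six
-- units ±ωⁱ of R are exactly the Shrikhande generators.
ω^_ : Fin 3 → R
ω^ 0F = 1F , 0F
ω^ 1F = 0F , 1F
ω^ 2F = 3F , 3F

ωF^_ : Fin 3 → F
ωF^ 0F = 1F , 0F
ωF^ 1F = 0F , 1F
ωF^ 2F = 1F , 1F

neg₃ : Fin 3 → Fin 3
neg₃ 0F = 0F
neg₃ 1F = 2F
neg₃ 2F = 1F

Unit6 : Set
Unit6 = Bool × Fin 3

unit : Unit6 → R
unit (true , i) = -R (ω^ i)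
unit (false , i) = ω^ i

negate inverse : Unit6 → Unit6
negate (s , i) = not s , i
inverse (s , i) = s , neg₃ i

-- Representatives 1 and 1 + 2ω of the units modulo ±ωⁱ.
coset : Bool → R
coset true = 1R
coset false = 1F , 2F

∀Unit6? : {P : Unit6 → Set} → ((u : Unit6) → Dec (P u)) → Dec ((u : Unit6) → P u)
∀Unit6? P? = map′ (λ p → uncurry p) (λ p s i → p (s , i)) (∀Bool? λ s → all? λ i → P? (s , i))

unit-negate : ∀ u → unit (negate u) ≡ (-R 1R) *R unit u
unit-negate = from-yes (∀Unit6? λ u → unit (negate u) ≟R ((-R 1R) *R unit u))

unit-inverseˡ : ∀ u → unit (inverse u) *R unit u ≡ 1R
unit-inverseˡ = from-yes (∀Unit6? λ u → (unit (inverse u) *R unit u) ≟R 1R)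

unit-inverseʳ : ∀ u → unit u *R unit (inverse u) ≡ 1R
unit-inverseʳ = from-yes (∀Unit6? λ u → (unit u *R unit (inverse u)) ≟R 1R)

ω-inverseʳ : ∀ i → ω^ i *R ω^ (neg₃ i) ≡ 1R
ω-inverseʳ = from-yes (all? λ i → (ω^ i *R ω^ (neg₃ i)) ≟R 1R)

ω-inverseˡ : ∀ i → ω^ (neg₃ i) *R ω^ i ≡ 1R
ω-inverseˡ = from-yes (all? λ i → (ω^ (neg₃ i) *R ω^ i) ≟R 1R)

red-ω : ∀ i → red (ω^ i) ≡ ωF^ i
red-ω = from-yes (all? λ i → red (ω^ i) ≟F ωF^ i)

red-unit : ∀ u → red (unit u) ≡ ωF^ (proj₂ u)
red-unit = from-yes (∀Unit6? λ u → red (unit u) ≟F ωF^ (proj₂ u))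

unit-*-two : ∀ s i → unit (s , i) *R 2R ≡ twice (ωF^ i)
unit-*-two = from-yes (∀Bool? λ s → all? λ i → (unit (s , i) *R 2R) ≟R twice (ωF^ i))

unit-*-ω : ∀ s i j → unit (s , i) *R ω^ j ≡ ω^ i *R unit (s , j)
unit-*-ω = from-yes (∀Bool? λ s → all? λ i → all? λ j →
  (unit (s , i) *R ω^ j) ≟R (ω^ i *R unit (s , j)))

data Shape : R → Set where
  zero : Shape 0R
  two  : (i : Fin 3) → Shape (twice (ωF^ i))
  unit×coset : (u : Unit6) (c : Bool) → Shape (unit u *R coset c)

shape : (r : R) → Shape r
shape (0F , 0F) = zero
shape (0F , 1F) = unit×coset (false , 1F) true
shape (0F , 2F) = two 1F
shape (0F , 3F) = unit×coset (true , 1F) true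
shape (1F , 0F) = unit×coset (false , 0F) true
shape (1F , 1F) = unit×coset (true , 2F) true
shape (1F , 2F) = unit×coset (false , 0F) false
shape (1F , 3F) = unit×coset (false , 2F) false
shape (2F , 0F) = two 0F
shape (2F , 1F) = unit×coset (true , 1F) false
shape (2F , 2F) = two 2F
shape (2F , 3F) = unit×coset (false , 1F) false
shape (3F , 0F) = unit×coset (true , 0F) true
shape (3F , 1F) = unit×coset (true , 2F) false
shape (3F , 2F) = unit×coset (true , 0F) false
shape (3F , 3F) = unit×coset (false , 2F) true

shape-unit : ∀ u c → shape (unit u *R coset c) ≡ unit×coset u c
shape-unit (true , 0F) true = refl
shape-unit (true , 1F) true = refl
shape-unit (true , 2F) true = refl
shape-unit (false , 0F) true = refl
shape-unit (false , 1F) true = refl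
shape-unit (false , 2F) true = refl
shape-unit (true , 0F) false = refl
shape-unit (true , 1F) false = refl
shape-unit (true , 2F) false = refl
shape-unit (false , 0F) false = refl
shape-unit (false , 1F) false = refl
shape-unit (false , 2F) false = refl

shape-two : ∀ i → shape (twice (ωF^ i)) ≡ two i
shape-two 0F = refl
shape-two 1F = refl
shape-two 2F = refl

data ShapeF : F → Set where
  zero : ShapeF 0F'
  pow  : (i : Fin 3) → ShapeF (ωF^ i)

shapeF : (f : F) → ShapeF f
shapeF (0F , 0F) = zero
shapeF (1F , 0F) = pow 0F
shapeF (0F , 1F) = pow 1F
shapeF (1F , 1F) = pow 2F

shapeF-pow : ∀ i → shapeF (ωF^ i) ≡ pow i
shapeF-pow 0F = refl
shapeF-pow 1F = refl
shapeF-pow 2F = refl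

module _ {A B C : Set} where
  map-map : {f : B → C} {g : A → B} {h : A → C} → (∀ a → f (g a) ≡ h a) →
            ∀ {n} (xs : Vec A n) → map f (map g xs) ≡ map h xs
  map-map {f} {g} e xs = trans (sym (Vec.map-∘ f g xs)) (Vec.map-cong e xs)

module _ {A B : Set} where
  map-zipWith : (f : A → B) {_⊕_ : A → A → A} {_⊗_ : B → B → B} →
                (∀ a b → f (a ⊕ b) ≡ f a ⊗ f b) →
                ∀ {n} (xs ys : Vec A n) → map f (zipWith _⊕_ xs ys) ≡ zipWith _⊗_ (map f xs) (map f ys)
  map-zipWith f e [] [] = refl
  map-zipWith f e (x ∷ xs) (y ∷ ys) = cong₂ _∷_ (e x y) (map-zipWith f e xs ys)

  zipWith-map-map : (f g h : A → B) {_⊗_ : B → B → B} → (∀ a → f a ⊗ g a ≡ h a) →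
                    ∀ {n} (xs : Vec A n) → zipWith _⊗_ (map f xs) (map g xs) ≡ map h xs
  zipWith-map-map f g h e [] = refl
  zipWith-map-map f g h e (x ∷ xs) = cong₂ _∷_ (e x) (zipWith-map-map f g h e xs)

module _ {A B : Set} (f : A → B) (f-injective : ∀ a b → f a ≡ f b → a ≡ b) where
  map-injective : ∀ {n} (xs ys : Vec A n) → map f xs ≡ map f ys → xs ≡ ys
  map-injective [] [] _ = refl
  map-injective (x ∷ xs) (y ∷ ys) e =
    cong₂ _∷_ (f-injective x y (Vec.∷-injectiveˡ e)) (map-injective xs ys (Vec.∷-injectiveʳ e))

-- The syndrome module Syn d g = F^g × R^d over R, where R acts on the
-- F-coordinates through red.  Its 2-torsion part is the image of
-- Tor d g = F^g × F^d under emb (b , a) = (b , 2a); on it R acts through F.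
record Syn (d g : ℕ) : Set where
  constructor syn
  field
    fpart : Vec F g
    rpart : Vec R d

record Tor (d g : ℕ) : Set where
  constructor tor
  field
    tfpart : Vec F g
    trpart : Vec F d

module _ {d g : ℕ} where
  infixl 6 _+S_ _+T_
  infixr 7 _·_ _·T_
  infix 4 _≟S_

  _+S_ : Syn d g → Syn d g → Syn d g
  syn b x +S syn b' x' = syn (zipWith _+F_ b b') (zipWith _+R_ x x')

  0S : Syn d g
  0S = syn (replicate g 0F') (replicate d 0R)

  _·_ : R → Syn d g → Syn d g
  r · syn b x = syn (map (red r *F_) b) (map (r *R_) x)

  _+T_ : Tor d g → Tor d g → Tor d g
  tor b a +T tor b' a' = tor (zipWith _+F_ b b') (zipWith _+F_ a a')

  0T : Tor d g
  0T = tor (replicate g 0F') (replicate d 0F')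

  _·T_ : F → Tor d g → Tor d g
  f ·T tor b a = tor (map (f *F_) b) (map (f *F_) a)

  emb : Tor d g → Syn d g
  emb (tor b a) = syn b (map twice a)

  +S-assoc : ∀ x y z → x +S y +S z ≡ x +S (y +S z)
  +S-assoc (syn b x) (syn b' x') (syn b'' x'') =
    cong₂ syn (Vec.zipWith-assoc +F-assoc b b' b'') (Vec.zipWith-assoc +R-assoc x x' x'')

  +S-comm : ∀ x y → x +S y ≡ y +S x
  +S-comm (syn b x) (syn b' x') = cong₂ syn (Vec.zipWith-comm +F-comm b b') (Vec.zipWith-comm +R-comm x x')

  +S-identityˡ : ∀ x → 0S +S x ≡ x
  +S-identityˡ (syn b x) = cong₂ syn (Vec.zipWith-identityˡ +F-identityˡ b) (Vec.zipWith-identityˡ +R-identityˡ x)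

  +S-identityʳ : ∀ x → x +S 0S ≡ x
  +S-identityʳ x = trans (+S-comm x 0S) (+S-identityˡ x)

  +S-swap : ∀ x y z → x +S y +S z ≡ x +S z +S y
  +S-swap x y z = trans (+S-assoc x y z) (trans (cong (x +S_) (+S-comm y z)) (sym (+S-assoc x z y)))

  ·-assoc : ∀ r s h → r · s · h ≡ (r *R s) · h
  ·-assoc r s (syn b x) = cong₂ syn
    (map-map (λ a → trans (sym (*F-assoc (red r) (red s) a)) (cong (_*F a) (sym (red-* r s)))) b)
    (map-map (λ a → sym (*R-assoc r s a)) x)

  ·-identity : ∀ h → 1R · h ≡ h
  ·-identity (syn b x) = cong₂ syn (trans (Vec.map-cong *F-identityˡ b) (Vec.map-id b))
                                   (trans (Vec.map-cong *R-identityˡ x) (Vec.map-id x))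

  ·-zero : ∀ h → 0R · h ≡ 0S
  ·-zero (syn b x) = cong₂ syn (trans (Vec.map-cong *F-zeroˡ b) (Vec.map-const b 0F'))
                               (trans (Vec.map-cong *R-zeroˡ x) (Vec.map-const x 0R))

  ·-distribʳ : ∀ r s h → (r +R s) · h ≡ r · h +S s · h
  ·-distribʳ r s (syn b x) = cong₂ syn
    (sym (zipWith-map-map _ _ _ (λ a → trans (sym (*F-distribʳ (red r) (red s) a)) (cong (_*F a) (sym (red-+ r s)))) b))
    (sym (zipWith-map-map _ _ _ (λ a → sym (*R-distribʳ r s a)) x))

  ·T-identity : ∀ t → 1F' ·T t ≡ t
  ·T-identity (tor b a) = cong₂ tor (trans (Vec.map-cong *F-identityˡ b) (Vec.map-id b))
                                    (trans (Vec.map-cong *F-identityˡ a) (Vec.map-id a))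

  ·T-distribʳ : ∀ f f' t → (f +F f') ·T t ≡ f ·T t +T f' ·T t
  ·T-distribʳ f f' (tor b a) = cong₂ tor (sym (zipWith-map-map _ _ _ (λ z → sym (*F-distribʳ f f' z)) b))
                                        (sym (zipWith-map-map _ _ _ (λ z → sym (*F-distribʳ f f' z)) a))

  emb-· : ∀ r t → r · emb t ≡ emb (red r ·T t)
  emb-· r (tor b a) = cong (syn _) (trans (map-map (*-twice r) a) (sym (map-map (λ _ → refl) a)))

  emb-+ : ∀ t t' → emb t +S emb t' ≡ emb (t +T t')
  emb-+ (tor b a) (tor b' a') = cong (syn _) (sym (map-zipWith twice (λ f f' → sym (twice-+ f f')) a a'))

  emb-0 : emb 0T ≡ 0S
  emb-0 = cong (syn _) (Vec.map-replicate twice 0F' d)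

  emb-negate : ∀ t → (-R 1R) · emb t ≡ emb t
  emb-negate t = trans (emb-· (-R 1R) t) (cong emb (·T-identity t))

  -- Additive cancellation, via -h = (-1)·h.
  +S-cancelʳ : ∀ a a' b → a +S b ≡ a' +S b → a ≡ a'
  +S-cancelʳ a a' b e = begin
    a                         ≡⟨ sym (+S-identityʳ a) ⟩
    a +S 0S                   ≡⟨ cong (a +S_) (sym inverse-b) ⟩
    a +S (b +S (-R 1R) · b)   ≡⟨ sym (+S-assoc a b _) ⟩
    a +S b +S (-R 1R) · b     ≡⟨ cong (_+S (-R 1R) · b) e ⟩
    a' +S b +S (-R 1R) · b    ≡⟨ +S-assoc a' b _ ⟩
    a' +S (b +S (-R 1R) · b)  ≡⟨ cong (a' +S_) inverse-b ⟩
    a' +S 0S                  ≡⟨ +S-identityʳ a' ⟩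
    a'                        ∎
    where
    inverse-b : b +S (-R 1R) · b ≡ 0S
    inverse-b = begin
      b +S (-R 1R) · b          ≡⟨ cong (_+S (-R 1R) · b) (sym (·-identity b)) ⟩
      1R · b +S (-R 1R) · b     ≡⟨ sym (·-distribʳ 1R (-R 1R) b) ⟩
      0R · b                    ≡⟨ ·-zero b ⟩
      0S                        ∎

  _≟S_ : DecidableEquality (Syn d g)
  syn b x ≟S syn b' x' with Vec.≡-dec _≟F_ b b' | Vec.≡-dec _≟R_ x x'
  ... | yes refl | yes refl = yes refl
  ... | no b≢b' | _ = no λ { refl → b≢b' refl }
  ... | yes _ | no x≢x' = no λ { refl → x≢x' refl }

emb-injective : ∀ {d g} (t t' : Tor d g) → emb t ≡ emb t' → t ≡ t'
emb-injective (tor b a) (tor b' a') e =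
  cong₂ tor (cong Syn.fpart e) (map-injective twice twice-injective a a' (cong Syn.rpart e))

module _ {d g : ℕ} where
  ·-cancel : ∀ r r' → r *R r' ≡ 1R → ∀ (h : Syn d g) → r · r' · h ≡ h
  ·-cancel r r' rr'≡1 h = trans (·-assoc r r' h) (trans (cong (_· h) rr'≡1) (·-identity h))

  emb-ω : ∀ i (t : Tor d g) → emb (ωF^ i ·T t) ≡ ω^ i · emb t
  emb-ω i t = trans (cong (λ f → emb (f ·T t)) (sym (red-ω i))) (sym (emb-· (ω^ i) t))

  unit-·-ω : ∀ s i j (h : Syn d g) → unit (s , i) · ω^ j · h ≡ ω^ i · unit (s , j) · h
  unit-·-ω s i j h = begin
    unit (s , i) · ω^ j · h          ≡⟨ ·-assoc (unit (s , i)) (ω^ j) h ⟩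
    (unit (s , i) *R ω^ j) · h       ≡⟨ cong (_· h) (unit-*-ω s i j) ⟩
    (ω^ i *R unit (s , j)) · h       ≡⟨ sym (·-assoc (ω^ i) (unit (s , j)) h) ⟩
    ω^ i · unit (s , j) · h          ∎

  ω⁻¹-·-emb : ∀ i (t : Tor d g) → ω^ (neg₃ i) · emb (ωF^ i ·T t) ≡ emb t
  ω⁻¹-·-emb i t = trans (cong (ω^ (neg₃ i) ·_) (emb-ω i t)) (·-cancel (ω^ (neg₃ i)) (ω^ i) (ω-inverseˡ i) (emb t))

-- An error of weight ≤ 1 is nothing, a unit ± ωⁱ
-- times a Shrikhande column, or ωⁱ times a K₄ column; the table is perfect
-- when every syndrome comes from exactly one such error.
data Err (S K : Set) : Set where
  none : Err S K
  shr  : S → Unit6 → Err S K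
  k4   : K → Fin 3 → Err S K

module _ {d g : ℕ} {S K : Set} (colS : S → Syn d g) (colK : K → Tor d g) where
  syndrome : Err S K → Syn d g
  syndrome none = 0S
  syndrome (shr s u) = unit u · colS s
  syndrome (k4 k i) = emb (ωF^ i ·T colK k)

-- The recursive construction keeps some columns in pairs (s , k) with
-- emb k = 2·s, indexed by Pair; these are later traded for ℤ₄-columns.
record Table (d g : ℕ) : Set₁ where
  field
    Pair ShrOnly K4Only : Set
    pairS : Pair → Syn d g
    pairK : Pair → Tor d g
    onlyS : ShrOnly → Syn d g
    onlyK : K4Only → Tor d g
    paired : ∀ c → emb (pairK c) ≡ 2R · pairS c
    decode : Syn d g → Err (Pair ⊎ ShrOnly) (Pair ⊎ K4Only)
    syndrome-decode : ∀ h → syndrome [ pairS , onlyS ] [ pairK , onlyK ] (decode h) ≡ h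
    decode-syndrome : ∀ e → decode (syndrome [ pairS , onlyS ] [ pairK , onlyK ] e) ≡ e

emptyTable : Table 0 0
emptyTable = record
  { Pair = ⊥ ; ShrOnly = ⊥ ; K4Only = ⊥
  ; pairS = λ () ; pairK = λ () ; onlyS = λ () ; onlyK = λ ()
  ; paired = λ ()
  ; decode = λ _ → none
  ; syndrome-decode = λ { (syn [] []) → refl }
  ; decode-syndrome = λ { none → refl ; (shr (inj₁ ()) _) ; (shr (inj₂ ()) _) ; (k4 (inj₁ ()) _) ; (k4 (inj₂ ()) _) }
  }

data Class {d g : ℕ} (S : Set) : Set where
  torsion    : Tor d g → Class S
  shrikhande : S → Unit6 → Class S

module TableFacts {d g : ℕ} (D : Table d g) where
  open Table D

  colS : Pair ⊎ ShrOnly → Syn d g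
  colS = [ pairS , onlyS ]

  colK : Pair ⊎ K4Only → Tor d g
  colK = [ pairK , onlyK ]

  Error : Set
  Error = Err (Pair ⊎ ShrOnly) (Pair ⊎ K4Only)

  σ : Error → Syn d g
  σ = syndrome colS colK

  σ-injective : ∀ e e' → σ e ≡ σ e' → e ≡ e'
  σ-injective e e' eq = trans (sym (decode-syndrome e)) (trans (cong decode eq) (decode-syndrome e'))

  -- A Shrikhande error never has a torsion syndrome: -1 fixes torsion, so
  -- the errors (l , u) and (l , -u) would share the syndrome.
  shr-not-torsion : ∀ l u t → σ (shr l u) ≢ emb t
  shr-not-torsion l u t eq = negate≢ u (shr-injective (σ-injective (shr l (negate u)) (shr l u) same))
    where
    negate≢ : ∀ u → negate u ≢ u
    negate≢ (true , i) ()
    negate≢ (false , i) ()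
    shr-injective : ∀ {u u'} → shr {K = Pair ⊎ K4Only} l u ≡ shr l u' → u ≡ u'
    shr-injective refl = refl
    same : σ (shr l (negate u)) ≡ σ (shr l u)
    same = begin
      unit (negate u) · colS l         ≡⟨ cong (_· colS l) (unit-negate u) ⟩
      ((-R 1R) *R unit u) · colS l     ≡⟨ sym (·-assoc (-R 1R) (unit u) (colS l)) ⟩
      (-R 1R) · unit u · colS l        ≡⟨ cong ((-R 1R) ·_) eq ⟩
      (-R 1R) · emb t                  ≡⟨ emb-negate t ⟩
      emb t                            ≡⟨ sym eq ⟩
      unit u · colS l                  ∎

  -- Classification reads the class off the decoded error; the torsion
  -- syndromes are exactly those of no error and of K₄ errors.
  classifyErr : Error → Class {d} {g} (Pair ⊎ ShrOnly)
  classifyErr none = torsion 0T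
  classifyErr (shr l u) = shrikhande l u
  classifyErr (k4 k i) = torsion (ωF^ i ·T colK k)

  classify : Syn d g → Class {d} {g} (Pair ⊎ ShrOnly)
  classify h = classifyErr (decode h)

  classifyErr-torsion : ∀ e t → classifyErr e ≡ torsion t → emb t ≡ σ e
  classifyErr-torsion none .0T refl = emb-0
  classifyErr-torsion (k4 k i) ._ refl = refl

  classifyErr-shr : ∀ e l u → classifyErr e ≡ shrikhande l u → e ≡ shr l u
  classifyErr-shr (shr l u) .l .u refl = refl

  classify-torsion : ∀ h t → classify h ≡ torsion t → emb t ≡ h
  classify-torsion h t eq = trans (classifyErr-torsion (decode h) t eq) (syndrome-decode h)

  classify-shr : ∀ h l u → classify h ≡ shrikhande l u → σ (shr l u) ≡ h
  classify-shr h l u eq = trans (cong σ (sym (classifyErr-shr (decode h) l u eq))) (syndrome-decode h)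

  classify-emb : ∀ t → classify (emb t) ≡ torsion t
  classify-emb t with classify (emb t) in eq
  ... | torsion t' = cong torsion (emb-injective t' t (classify-torsion (emb t) t' eq))
  ... | shrikhande l u = ⊥-elim (shr-not-torsion l u t (classify-shr (emb t) l u eq))

  classify-σ-shr : ∀ l u → classify (σ (shr l u)) ≡ shrikhande l u
  classify-σ-shr l u = cong classifyErr (decode-syndrome (shr l u))

  -- How classification interacts with multiplication by ωⁱ; these are the
  -- facts both growth steps use to handle a new coordinate equal to 2ωⁱ.
  torsion-ω : ∀ i h t → classify h ≡ torsion t → emb (ωF^ i ·T t) ≡ ω^ i · h
  torsion-ω i h t eq = trans (emb-ω i t) (cong (ω^ i ·_) (classify-torsion h t eq))

  shrikhande-ω : ∀ i h l s j → classify h ≡ shrikhande l (s , j) → unit (s , i) · ω^ j · colS l ≡ ω^ i · h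
  shrikhande-ω i h l s j eq = trans (unit-·-ω s i j (colS l)) (cong (ω^ i ·_) (classify-shr h l (s , j) eq))

  classify-ω-emb : ∀ i t → classify (ω^ (neg₃ i) · emb (ωF^ i ·T t)) ≡ torsion t
  classify-ω-emb i t = trans (cong classify (ω⁻¹-·-emb i t)) (classify-emb t)

  classify-ω-shr : ∀ i l s j → classify (ω^ (neg₃ i) · unit (s , i) · ω^ j · colS l) ≡ shrikhande l (s , j)
  classify-ω-shr i l s j = trans (cong classify shift) (classify-σ-shr l (s , j))
    where
    shift : ω^ (neg₃ i) · unit (s , i) · ω^ j · colS l ≡ unit (s , j) · colS l
    shift = trans (cong (ω^ (neg₃ i) ·_) (unit-·-ω s i j (colS l)))
                  (·-cancel (ω^ (neg₃ i)) (ω^ i) (ω-inverseˡ i) (unit (s , j) · colS l))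

-- Nonzero vectors of F^k, enumerated by the position of the first nonzero
-- entry, and the view deciding whether a vector is zero.
NonZero : ℕ → Set
NonZero zero = ⊥
NonZero (suc k) = (Fin 3 × Vec F k) ⊎ NonZero k

nonzero : ∀ {k} → NonZero k → Vec F k
nonzero {suc k} (inj₁ (i , v)) = ωF^ i ∷ v
nonzero {suc k} (inj₂ z) = 0F' ∷ nonzero z

data ZeroView : ∀ {k} → Vec F k → Set where
  isZero  : ∀ {k} → ZeroView (replicate k 0F')
  nonZero : ∀ {k} (z : NonZero k) → ZeroView (nonzero z)

zeroView : ∀ {k} (v : Vec F k) → ZeroView v
zeroView [] = isZero
zeroView (f ∷ v) = cons (shapeF f) (zeroView v)
  where
  cons : ∀ {k f} {v : Vec F k} → ShapeF f → ZeroView v → ZeroView (f ∷ v)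
  cons zero isZero = isZero
  cons zero (nonZero z) = nonZero (inj₂ z)
  cons {v = v} (pow i) _ = nonZero (inj₁ (i , v))

zeroView-zero : ∀ k → zeroView (replicate k 0F') ≡ isZero
zeroView-zero zero = refl
zeroView-zero (suc k) rewrite zeroView-zero k = refl

zeroView-nonzero : ∀ {k} (z : NonZero k) → zeroView (nonzero z) ≡ nonZero z
zeroView-nonzero {suc k} (inj₁ (i , v)) rewrite shapeF-pow i = refl
zeroView-nonzero {suc k} (inj₂ z) rewrite zeroView-nonzero z = refl

digitsV : ∀ {k} → Vec F k → Vec F k → Vec R k
digitsV = zipWith (λ a b → lift a +R twice b)

red-digitsV : ∀ {k} (a b : Vec F k) → map red (digitsV a b) ≡ a
red-digitsV [] [] = refl
red-digitsV (x ∷ a) (y ∷ b) = cong₂ _∷_ (red-digits x y) (red-digitsV a b)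

high-digitsV : ∀ {k} (a b : Vec F k) → map high (digitsV a b) ≡ b
high-digitsV [] [] = refl
high-digitsV (x ∷ a) (y ∷ b) = cong₂ _∷_ (high-digits x y) (high-digitsV a b)

digitsV-split : ∀ {k} (x : Vec R k) → digitsV (map red x) (map high x) ≡ x
digitsV-split [] = refl
digitsV-split (r ∷ x) = cong₂ _∷_ (digits r) (digitsV-split x)

two-·-digitsV : ∀ {k} (a : Vec F k) → map (2R *R_) (digitsV a (replicate k 0F')) ≡ map twice a
two-·-digitsV [] = refl
two-·-digitsV (f ∷ a) = cong₂ _∷_ (two-*-lift f) (two-·-digitsV a)

module _ {d g : ℕ} where
  consR : R → Syn d g → Syn (suc d) g
  consR r h = syn (Syn.fpart h) (r ∷ Syn.rpart h)

  consRT : F → Tor d g → Tor (suc d) g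
  consRT f t = tor (Tor.tfpart t) (f ∷ Tor.trpart t)

  consF : F → Syn d g → Syn d (suc g)
  consF f h = syn (f ∷ Syn.fpart h) (Syn.rpart h)

  consFT : F → Tor d g → Tor d (suc g)
  consFT f t = tor (f ∷ Tor.tfpart t) (Tor.trpart t)

-- Writing the
-- new coordinate first, the Shrikhande columns are (0 , s) for old s,
-- (1 , lift a + twice b) and (1 + 2ω , lift a + twice b) for a, b ∈ F^d,
-- and (2 , ωʲ s) for old s; the K₄ columns are (0 , k) for old k and
-- (1 , a), the latter paired with (1 , lift a).  A syndrome (r , h) is
-- decoded by the shape of r: if r = 0 decode h in the old table, if
-- r = 2ωⁱ classify ω⁻ⁱh, and if r = u·c read off the column u⁻¹h.
module RowStep {d : ℕ} (D : Table d 0) where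
  open Table D
  open TableFacts D

  Pair' ShrOnly' K4Only' : Set
  Pair' = Pair ⊎ Vec F d
  ShrOnly' = ShrOnly ⊎ (((Vec F d × NonZero d) ⊎ (Vec F d × Vec F d)) ⊎ ((Pair ⊎ ShrOnly) × Fin 3))
  K4Only' = K4Only

  zeros : Vec F d
  zeros = replicate d 0F'

  column : Vec F d → Vec F d → Syn d 0
  column a b = syn [] (digitsV a b)

  pairS' : Pair' → Syn (suc d) 0
  pairS' (inj₁ c) = consR 0R (pairS c)
  pairS' (inj₂ a) = consR 1R (column a zeros)

  onlyS' : ShrOnly' → Syn (suc d) 0
  onlyS' (inj₁ o) = consR 0R (onlyS o)
  onlyS' (inj₂ (inj₁ (inj₁ (a , z)))) = consR 1R (column a (nonzero z))
  onlyS' (inj₂ (inj₁ (inj₂ (a , b)))) = consR (coset false) (column a b)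
  onlyS' (inj₂ (inj₂ (l , j))) = consR 2R (ω^ j · colS l)

  pairK' : Pair' → Tor (suc d) 0
  pairK' (inj₁ c) = consRT 0F' (pairK c)
  pairK' (inj₂ a) = consRT 1F' (tor [] a)

  onlyK' : K4Only' → Tor (suc d) 0
  onlyK' o = consRT 0F' (onlyK o)

  paired' : ∀ c → emb (pairK' c) ≡ 2R · pairS' c
  paired' (inj₁ c) = cong (consR 0R) (paired c)
  paired' (inj₂ a) = cong (λ x → syn [] (twice 1F' ∷ x)) (sym (two-·-digitsV a))

  Error' : Set
  Error' = Err (Pair' ⊎ ShrOnly') (Pair' ⊎ K4Only')

  σ' : Error' → Syn (suc d) 0
  σ' = syndrome [ pairS' , onlyS' ] [ pairK' , onlyK' ]

  liftErr : Error → Error'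
  liftErr none = none
  liftErr (shr (inj₁ c) u) = shr (inj₁ (inj₁ c)) u
  liftErr (shr (inj₂ o) u) = shr (inj₂ (inj₁ o)) u
  liftErr (k4 (inj₁ c) i) = k4 (inj₁ (inj₁ c)) i
  liftErr (k4 (inj₂ o) i) = k4 (inj₂ o) i

  twoErr : Fin 3 → Class {d} {0} (Pair ⊎ ShrOnly) → Error'
  twoErr i (torsion t) = k4 (inj₁ (inj₂ (Tor.trpart t))) i
  twoErr i (shrikhande l (s , j)) = shr (inj₂ (inj₂ (inj₂ (l , j)))) (s , i)

  unitErr : Unit6 → Bool → Vec F d → {b : Vec F d} → ZeroView b → Error'
  unitErr u true a isZero = shr (inj₁ (inj₂ a)) u
  unitErr u true a (nonZero z) = shr (inj₂ (inj₂ (inj₁ (inj₁ (a , z))))) u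
  unitErr u false a {b} _ = shr (inj₂ (inj₂ (inj₁ (inj₂ (a , b))))) u

  unitErrAt : Unit6 → Bool → Syn d 0 → Error'
  unitErrAt u c h = unitErr u c (map red (Syn.rpart h)) (zeroView (map high (Syn.rpart h)))

  decodeBy : (r : R) → Shape r → Syn d 0 → Error'
  decodeBy _ zero h = liftErr (decode h)
  decodeBy _ (two i) h = twoErr i (classify (ω^ (neg₃ i) · h))
  decodeBy _ (unit×coset u c) h = unitErrAt u c (unit (inverse u) · h)

  decode' : Syn (suc d) 0 → Error'
  decode' (syn b (r ∷ x)) = decodeBy r (shape r) (syn b x)

  σ'-lift : ∀ e → σ' (liftErr e) ≡ consR 0R (σ e)
  σ'-lift none = refl
  σ'-lift (shr (inj₁ c) u) = cong (λ r → consR r (unit u · pairS c)) (*R-zeroʳ (unit u))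
  σ'-lift (shr (inj₂ o) u) = cong (λ r → consR r (unit u · onlyS o)) (*R-zeroʳ (unit u))
  σ'-lift (k4 (inj₁ c) i) = cong (λ f → consR (twice f) (emb (ωF^ i ·T pairK c))) (*F-zeroʳ (ωF^ i))
  σ'-lift (k4 (inj₂ o) i) = cong (λ f → consR (twice f) (emb (ωF^ i ·T onlyK o))) (*F-zeroʳ (ωF^ i))

  σ'-two : ∀ i h → σ' (twoErr i (classify h)) ≡ consR (twice (ωF^ i)) (ω^ i · h)
  σ'-two i h with classify h in eq
  ... | torsion (tor [] a) = cong₂ consR (cong twice (*F-identityʳ (ωF^ i))) (torsion-ω i h (tor [] a) eq)
  ... | shrikhande l (s , j) = cong₂ consR (unit-*-two s i) (shrikhande-ω i h l s j eq)

  σ'-unit : ∀ u c a {b} (v : ZeroView b) → σ' (unitErr u c a v) ≡ consR (unit u *R coset c) (unit u · column a b)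
  σ'-unit u true a isZero = refl
  σ'-unit u true a (nonZero z) = refl
  σ'-unit u false a v = refl

  column-split : ∀ h → column (map red (Syn.rpart h)) (map high (Syn.rpart h)) ≡ h
  column-split (syn [] x) = cong (syn []) (digitsV-split x)

  syndrome-decode' : ∀ h → σ' (decode' h) ≡ h
  syndrome-decode' (syn b (r ∷ x)) = byShape r (shape r) (syn b x)
    where
    byShape : ∀ r (v : Shape r) h → σ' (decodeBy r v h) ≡ consR r h
    byShape _ zero h = trans (σ'-lift (decode h)) (cong (consR 0R) (syndrome-decode h))
    byShape _ (two i) h =
      trans (σ'-two i _) (cong (consR _) (·-cancel (ω^ i) (ω^ (neg₃ i)) (ω-inverseʳ i) h))
    byShape _ (unit×coset u c) h =
      trans (σ'-unit u c _ (zeroView _))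
            (cong (consR _) (trans (cong (unit u ·_) (column-split (unit (inverse u) · h)))
                                   (·-cancel (unit u) (unit (inverse u)) (unit-inverseʳ u) h)))

  decode-lift : ∀ e → decode' (σ' (liftErr e)) ≡ liftErr e
  decode-lift e = trans (cong decode' (σ'-lift e)) (cong liftErr (decode-syndrome e))

  decode-two : ∀ i h → decode' (consR (twice (ωF^ i)) h) ≡ twoErr i (classify (ω^ (neg₃ i) · h))
  decode-two i h = cong (λ v → decodeBy _ v h) (shape-two i)

  decode-column : ∀ u c a b → decode' (consR (unit u *R coset c) (unit u · column a b)) ≡ unitErr u c a (zeroView b)
  decode-column u c a b = begin
    decodeBy _ (shape (unit u *R coset c)) (unit u · column a b)
      ≡⟨ cong (λ v → decodeBy _ v (unit u · column a b)) (shape-unit u c) ⟩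
    unitErrAt u c (unit (inverse u) · unit u · column a b)
      ≡⟨ cong (unitErrAt u c) (·-cancel (unit (inverse u)) (unit u) (unit-inverseˡ u) (column a b)) ⟩
    unitErrAt u c (column a b)
      ≡⟨ cong₂ (λ a' b' → unitErr u c a' (zeroView b')) (red-digitsV a b) (high-digitsV a b) ⟩
    unitErr u c a (zeroView b) ∎

  decode-syndrome' : ∀ e → decode' (σ' e) ≡ e
  decode-syndrome' none = decode-lift none
  decode-syndrome' (shr (inj₁ (inj₁ c)) u) = decode-lift (shr (inj₁ c) u)
  decode-syndrome' (shr (inj₂ (inj₁ o)) u) = decode-lift (shr (inj₂ o) u)
  decode-syndrome' (k4 (inj₁ (inj₁ c)) i) = decode-lift (k4 (inj₁ c) i)
  decode-syndrome' (k4 (inj₂ o) i) = decode-lift (k4 (inj₂ o) i)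
  decode-syndrome' (shr (inj₁ (inj₂ a)) u) =
    trans (decode-column u true a zeros) (cong (unitErr u true a) (zeroView-zero d))
  decode-syndrome' (shr (inj₂ (inj₂ (inj₁ (inj₁ (a , z))))) u) =
    trans (decode-column u true a (nonzero z)) (cong (unitErr u true a) (zeroView-nonzero z))
  decode-syndrome' (shr (inj₂ (inj₂ (inj₁ (inj₂ (a , b))))) u) = decode-column u false a b
  decode-syndrome' (shr (inj₂ (inj₂ (inj₂ (l , j)))) (s , i)) = begin
    decode' (consR (unit (s , i) *R 2R) x)  ≡⟨ cong (λ r → decode' (consR r x)) (unit-*-two s i) ⟩
    decode' (consR (twice (ωF^ i)) x)       ≡⟨ decode-two i x ⟩
    twoErr i (classify (ω^ (neg₃ i) · x))   ≡⟨ cong (twoErr i) (classify-ω-shr i l s j) ⟩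
    shr (inj₂ (inj₂ (inj₂ (l , j)))) (s , i) ∎
    where
    x = unit (s , i) · ω^ j · colS l
  decode-syndrome' (k4 (inj₁ (inj₂ a)) i) = begin
    decode' (consR (twice (ωF^ i *F 1F')) x) ≡⟨ cong (λ f → decode' (consR (twice f) x)) (*F-identityʳ (ωF^ i)) ⟩
    decode' (consR (twice (ωF^ i)) x)        ≡⟨ decode-two i x ⟩
    twoErr i (classify (ω^ (neg₃ i) · x))    ≡⟨ cong (twoErr i) (classify-ω-emb i (tor [] a)) ⟩
    k4 (inj₁ (inj₂ a)) i                     ∎
    where
    x = emb (ωF^ i ·T tor [] a)

rowStep : ∀ {d} → Table d 0 → Table (suc d) 0
rowStep D = record
  { Pair = Pair' ; ShrOnly = ShrOnly' ; K4Only = K4Only'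
  ; pairS = pairS' ; pairK = pairK' ; onlyS = onlyS' ; onlyK = onlyK'
  ; paired = paired'
  ; decode = decode'
  ; syndrome-decode = syndrome-decode'
  ; decode-syndrome = decode-syndrome' }
  where open RowStep D

-- The new Shrikhande columns are (0 , s) and (1 , ωʲ s)
-- for old s, the new K₄ columns (0 , k) for old k and (1 , t) for every
-- t ∈ Tor d g.  A syndrome (f , h) with f = 0 is decoded in the old table;
-- if f = ωⁱ, the class of ω⁻ⁱh determines the error.
module ColumnStep {d g : ℕ} (D : Table d g) where
  open Table D
  open TableFacts D

  ShrOnly' K4Only' : Set
  ShrOnly' = ShrOnly ⊎ ((Pair ⊎ ShrOnly) × Fin 3)
  K4Only' = K4Only ⊎ Tor d g

  pairS' : Pair → Syn d (suc g)
  pairS' c = consF 0F' (pairS c)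

  onlyS' : ShrOnly' → Syn d (suc g)
  onlyS' (inj₁ o) = consF 0F' (onlyS o)
  onlyS' (inj₂ (l , j)) = consF 1F' (ω^ j · colS l)

  pairK' : Pair → Tor d (suc g)
  pairK' c = consFT 0F' (pairK c)

  onlyK' : K4Only' → Tor d (suc g)
  onlyK' (inj₁ o) = consFT 0F' (onlyK o)
  onlyK' (inj₂ t) = consFT 1F' t

  Error' : Set
  Error' = Err (Pair ⊎ ShrOnly') (Pair ⊎ K4Only')

  σ' : Error' → Syn d (suc g)
  σ' = syndrome [ pairS' , onlyS' ] [ pairK' , onlyK' ]

  liftErr : Error → Error'
  liftErr none = none
  liftErr (shr (inj₁ c) u) = shr (inj₁ c) u
  liftErr (shr (inj₂ o) u) = shr (inj₂ (inj₁ o)) u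
  liftErr (k4 (inj₁ c) i) = k4 (inj₁ c) i
  liftErr (k4 (inj₂ o) i) = k4 (inj₂ (inj₁ o)) i

  twoErr : Fin 3 → Class {d} {g} (Pair ⊎ ShrOnly) → Error'
  twoErr i (torsion t) = k4 (inj₂ (inj₂ t)) i
  twoErr i (shrikhande l (s , j)) = shr (inj₂ (inj₂ (l , j))) (s , i)

  decodeBy : (f : F) → ShapeF f → Syn d g → Error'
  decodeBy _ zero h = liftErr (decode h)
  decodeBy _ (pow i) h = twoErr i (classify (ω^ (neg₃ i) · h))

  decode' : Syn d (suc g) → Error'
  decode' (syn (f ∷ b) x) = decodeBy f (shapeF f) (syn b x)

  σ'-lift : ∀ e → σ' (liftErr e) ≡ consF 0F' (σ e)
  σ'-lift none = refl
  σ'-lift (shr (inj₁ c) u) = cong (λ f → consF f (unit u · pairS c)) (*F-zeroʳ (red (unit u)))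
  σ'-lift (shr (inj₂ o) u) = cong (λ f → consF f (unit u · onlyS o)) (*F-zeroʳ (red (unit u)))
  σ'-lift (k4 (inj₁ c) i) = cong (λ f → consF f (emb (ωF^ i ·T pairK c))) (*F-zeroʳ (ωF^ i))
  σ'-lift (k4 (inj₂ o) i) = cong (λ f → consF f (emb (ωF^ i ·T onlyK o))) (*F-zeroʳ (ωF^ i))

  red-unit-*-1 : ∀ s i → red (unit (s , i)) *F 1F' ≡ ωF^ i
  red-unit-*-1 s i = trans (*F-identityʳ _) (red-unit (s , i))

  σ'-two : ∀ i h → σ' (twoErr i (classify h)) ≡ consF (ωF^ i) (ω^ i · h)
  σ'-two i h with classify h in eq
  ... | torsion t = cong₂ consF (*F-identityʳ (ωF^ i)) (torsion-ω i h t eq)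
  ... | shrikhande l (s , j) = cong₂ consF (red-unit-*-1 s i) (shrikhande-ω i h l s j eq)

  syndrome-decode' : ∀ h → σ' (decode' h) ≡ h
  syndrome-decode' (syn (f ∷ b) x) = byShape f (shapeF f) (syn b x)
    where
    byShape : ∀ f (v : ShapeF f) h → σ' (decodeBy f v h) ≡ consF f h
    byShape _ zero h = trans (σ'-lift (decode h)) (cong (consF 0F') (syndrome-decode h))
    byShape _ (pow i) h =
      trans (σ'-two i _) (cong (consF _) (·-cancel (ω^ i) (ω^ (neg₃ i)) (ω-inverseʳ i) h))

  decode-lift : ∀ e → decode' (σ' (liftErr e)) ≡ liftErr e
  decode-lift e = trans (cong decode' (σ'-lift e)) (cong liftErr (decode-syndrome e))

  decode-pow : ∀ {f} i h → f ≡ ωF^ i → decode' (consF f h) ≡ twoErr i (classify (ω^ (neg₃ i) · h))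
  decode-pow i h refl = cong (λ v → decodeBy _ v h) (shapeF-pow i)

  decode-syndrome' : ∀ e → decode' (σ' e) ≡ e
  decode-syndrome' none = decode-lift none
  decode-syndrome' (shr (inj₁ c) u) = decode-lift (shr (inj₁ c) u)
  decode-syndrome' (shr (inj₂ (inj₁ o)) u) = decode-lift (shr (inj₂ o) u)
  decode-syndrome' (k4 (inj₁ c) i) = decode-lift (k4 (inj₁ c) i)
  decode-syndrome' (k4 (inj₂ (inj₁ o)) i) = decode-lift (k4 (inj₂ o) i)
  decode-syndrome' (shr (inj₂ (inj₂ (l , j))) (s , i)) =
    trans (decode-pow i _ (red-unit-*-1 s i)) (cong (twoErr i) (classify-ω-shr i l s j))
  decode-syndrome' (k4 (inj₂ (inj₂ t)) i) =
    trans (decode-pow i _ (*F-identityʳ (ωF^ i))) (cong (twoErr i) (classify-ω-emb i t))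

columnStep : ∀ {d g} → Table d g → Table d (suc g)
columnStep D = record
  { Pair = Table.Pair D ; ShrOnly = ShrOnly' ; K4Only = K4Only'
  ; pairS = pairS' ; pairK = pairK' ; onlyS = onlyS' ; onlyK = onlyK'
  ; paired = λ c → cong (consF 0F') (Table.paired D c)
  ; decode = decode'
  ; syndrome-decode = syndrome-decode'
  ; decode-syndrome = decode-syndrome' }
  where open ColumnStep D

module _ {A B : Set} {m n : ℕ} where
  ↔Fin-⊎ : A ↔ Fin m → B ↔ Fin n → (A ⊎ B) ↔ Fin (m + n)
  ↔Fin-⊎ p q = ↔-trans (p ⊎-↔ q) (↔-sym +↔⊎)

  ↔Fin-× : A ↔ Fin m → B ↔ Fin n → (A × B) ↔ Fin (m * n)
  ↔Fin-× p q = ↔-trans (p ×-↔ q) (↔-sym *↔×)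

↔Fin-Vec : ∀ {A : Set} {n} → A ↔ Fin n → ∀ k → Vec A k ↔ Fin (n ^ k)
↔Fin-Vec p zero = mk↔ₛ′ (λ _ → fzero) (λ _ → []) (λ { fzero → refl ; (fsuc ()) }) (λ { [] → refl })
↔Fin-Vec {A} p (suc k) = ↔-trans uncons (↔Fin-× p (↔Fin-Vec p k))
  where
  uncons : Vec A (suc k) ↔ (A × Vec A k)
  uncons = mk↔ₛ′ (λ { (x ∷ xs) → x , xs }) (uncurry _∷_) (λ _ → refl) (λ { (x ∷ xs) → refl })

↔Fin-⊥ : ⊥ ↔ Fin 0
↔Fin-⊥ = ↔-sym 0↔⊥

↔Fin-F : F ↔ Fin 4
↔Fin-F = ↔Fin-× ↔-refl ↔-refl

↔Fin-Tor : ∀ d g → Tor d g ↔ Fin (4 ^ g * 4 ^ d)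
↔Fin-Tor d g = ↔-trans (mk↔ₛ′ (λ { (tor b a) → b , a }) (uncurry tor) (λ _ → refl) (λ _ → refl))
                       (↔Fin-× (↔Fin-Vec ↔Fin-F g) (↔Fin-Vec ↔Fin-F d))

#NonZero : ℕ → ℕ
#NonZero zero = 0
#NonZero (suc k) = 3 * 4 ^ k + #NonZero k

↔Fin-NonZero : ∀ k → NonZero k ↔ Fin (#NonZero k)
↔Fin-NonZero zero = ↔Fin-⊥
↔Fin-NonZero (suc k) = ↔Fin-⊎ (↔Fin-× ↔-refl (↔Fin-Vec ↔Fin-F k)) (↔Fin-NonZero k)

#NonZero-suc : ∀ k → 1 + #NonZero k ≡ 4 ^ k
#NonZero-suc zero = refl
#NonZero-suc (suc k) = begin
  1 + (3 * 4 ^ k + #NonZero k)   ≡⟨ rearrange (4 ^ k) (#NonZero k) ⟩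
  (1 + #NonZero k) + 3 * 4 ^ k   ≡⟨ cong (_+ 3 * 4 ^ k) (#NonZero-suc k) ⟩
  4 ^ k + 3 * 4 ^ k              ≡⟨ four-times (4 ^ k) ⟩
  4 * 4 ^ k                      ∎
  where
  rearrange : ∀ x n → 1 + (3 * x + n) ≡ (1 + n) + 3 * x
  rearrange = solve-∀
  four-times : ∀ x → x + 3 * x ≡ 4 * x
  four-times = solve-∀

-- A perfect table with finite index sets of known sizes.  The three
-- identities say that the pairs, the torsion syndromes (0 and the K₄
-- errors) and all syndromes are counted correctly.
record SizedTable (d g : ℕ) : Set₁ where
  field
    table : Table d g
    #Pair #ShrOnly #K4Only : ℕ
    ↔Pair    : Table.Pair table ↔ Fin #Pair
    ↔ShrOnly : Table.ShrOnly table ↔ Fin #ShrOnly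
    ↔K4Only  : Table.K4Only table ↔ Fin #K4Only
    count-pairs   : 1 + 3 * #Pair ≡ 4 ^ d
    count-torsion : 1 + 3 * (#Pair + #K4Only) ≡ 4 ^ d * 4 ^ g
    count-all     : 4 ^ d * 4 ^ g + 6 * (#Pair + #ShrOnly) ≡ 4 ^ d * 4 ^ d * 4 ^ g

emptySized : SizedTable 0 0
emptySized = record
  { table = emptyTable ; #Pair = 0 ; #ShrOnly = 0 ; #K4Only = 0
  ; ↔Pair = ↔Fin-⊥ ; ↔ShrOnly = ↔Fin-⊥ ; ↔K4Only = ↔Fin-⊥
  ; count-pairs = refl ; count-torsion = refl ; count-all = refl }

-- The counting identities after a row step (X = 4^d, z = |NonZero d|).
module RowCount (nC nS nK X z : ℕ) where
  pairs′ : 1 + 3 * nC ≡ X → 1 + 3 * (nC + X) ≡ 4 * X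
  pairs′ e = begin
    1 + 3 * (nC + X)     ≡⟨ rearrange nC X ⟩
    (1 + 3 * nC) + 3 * X ≡⟨ cong (_+ 3 * X) e ⟩
    X + 3 * X            ≡⟨ four-times X ⟩
    4 * X                ∎
    where
    rearrange : ∀ c x → 1 + 3 * (c + x) ≡ (1 + 3 * c) + 3 * x
    rearrange = solve-∀
    four-times : ∀ x → x + 3 * x ≡ 4 * x
    four-times = solve-∀

  torsion′ : 1 + 3 * (nC + nK) ≡ X * 1 → 1 + 3 * ((nC + X) + nK) ≡ 4 * X * 1
  torsion′ e = begin
    1 + 3 * ((nC + X) + nK)     ≡⟨ rearrange nC X nK ⟩
    (1 + 3 * (nC + nK)) + 3 * X ≡⟨ cong (_+ 3 * X) e ⟩
    X * 1 + 3 * X               ≡⟨ four-times X ⟩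
    4 * X * 1                   ∎
    where
    rearrange : ∀ c x k → 1 + 3 * ((c + x) + k) ≡ (1 + 3 * (c + k)) + 3 * x
    rearrange = solve-∀
    four-times : ∀ x → x * 1 + 3 * x ≡ 4 * x * 1
    four-times = solve-∀

  all′ : X * 1 + 6 * (nC + nS) ≡ X * X * 1 → 1 + z ≡ X →
        4 * X * 1 + 6 * ((nC + X) + (nS + ((X * z + X * X) + (nC + nS) * 3))) ≡ 4 * X * (4 * X) * 1
  all′ e ez = begin
    4 * X * 1 + 6 * ((nC + X) + (nS + ((X * z + X * X) + (nC + nS) * 3)))
      ≡⟨ rearrange nC nS X z ⟩
    4 * (X * 1 + 6 * (nC + nS)) + 6 * X * (1 + z) + 6 * X * X
      ≡⟨ cong₂ (λ a b → 4 * a + 6 * X * b + 6 * X * X) e ez ⟩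
    4 * (X * X * 1) + 6 * X * X + 6 * X * X
      ≡⟨ sixteen X ⟩
    4 * X * (4 * X) * 1 ∎
    where
    rearrange : ∀ c s x z → 4 * x * 1 + 6 * ((c + x) + (s + ((x * z + x * x) + (c + s) * 3)))
                            ≡ 4 * (x * 1 + 6 * (c + s)) + 6 * x * (1 + z) + 6 * x * x
    rearrange = solve-∀
    sixteen : ∀ x → 4 * (x * x * 1) + 6 * x * x + 6 * x * x ≡ 4 * x * (4 * x) * 1
    sixteen = solve-∀

sizedRowStep : ∀ {d} → SizedTable d 0 → SizedTable (suc d) 0
sizedRowStep {d} S = record
  { table = rowStep table
  ; #Pair = #Pair + 4 ^ d
  ; #ShrOnly = #ShrOnly + ((4 ^ d * #NonZero d + 4 ^ d * 4 ^ d) + (#Pair + #ShrOnly) * 3)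
  ; #K4Only = #K4Only
  ; ↔Pair = ↔Fin-⊎ ↔Pair vectors
  ; ↔ShrOnly = ↔Fin-⊎ ↔ShrOnly (↔Fin-⊎ (↔Fin-⊎ (↔Fin-× vectors (↔Fin-NonZero d)) (↔Fin-× vectors vectors))
                                        (↔Fin-× (↔Fin-⊎ ↔Pair ↔ShrOnly) ↔-refl))
  ; ↔K4Only = ↔K4Only
  ; count-pairs = C.pairs′ count-pairs
  ; count-torsion = C.torsion′ count-torsion
  ; count-all = C.all′ count-all (#NonZero-suc d) }
  where
  open SizedTable S
  module C = RowCount #Pair #ShrOnly #K4Only (4 ^ d) (#NonZero d)
  vectors : Vec F d ↔ Fin (4 ^ d)
  vectors = ↔Fin-Vec ↔Fin-F d

-- The counting identities after a column step (X = 4^d, Y = 4^g).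
module ColumnCount (nC nS nK X Y : ℕ) where
  torsion′ : 1 + 3 * (nC + nK) ≡ X * Y → 1 + 3 * (nC + (nK + Y * X)) ≡ X * (4 * Y)
  torsion′ e = begin
    1 + 3 * (nC + (nK + Y * X))       ≡⟨ rearrange nC nK X Y ⟩
    (1 + 3 * (nC + nK)) + 3 * (Y * X) ≡⟨ cong (_+ 3 * (Y * X)) e ⟩
    X * Y + 3 * (Y * X)               ≡⟨ four-times X Y ⟩
    X * (4 * Y)                       ∎
    where
    rearrange : ∀ c k x y → 1 + 3 * (c + (k + y * x)) ≡ (1 + 3 * (c + k)) + 3 * (y * x)
    rearrange = solve-∀
    four-times : ∀ x y → x * y + 3 * (y * x) ≡ x * (4 * y)
    four-times = solve-∀

  all′ : X * Y + 6 * (nC + nS) ≡ X * X * Y → X * (4 * Y) + 6 * (nC + (nS + (nC + nS) * 3)) ≡ X * X * (4 * Y)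
  all′ e = begin
    X * (4 * Y) + 6 * (nC + (nS + (nC + nS) * 3)) ≡⟨ rearrange nC nS X Y ⟩
    4 * (X * Y + 6 * (nC + nS))                   ≡⟨ cong (4 *_) e ⟩
    4 * (X * X * Y)                               ≡⟨ four-times X Y ⟩
    X * X * (4 * Y)                               ∎
    where
    rearrange : ∀ c s x y → x * (4 * y) + 6 * (c + (s + (c + s) * 3)) ≡ 4 * (x * y + 6 * (c + s))
    rearrange = solve-∀
    four-times : ∀ x y → 4 * (x * x * y) ≡ x * x * (4 * y)
    four-times = solve-∀

sizedColumnStep : ∀ {d g} → SizedTable d g → SizedTable d (suc g)
sizedColumnStep {d} {g} S = record
  { table = columnStep table
  ; #Pair = #Pair
  ; #ShrOnly = #ShrOnly + (#Pair + #ShrOnly) * 3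
  ; #K4Only = #K4Only + 4 ^ g * 4 ^ d
  ; ↔Pair = ↔Pair
  ; ↔ShrOnly = ↔Fin-⊎ ↔ShrOnly (↔Fin-× (↔Fin-⊎ ↔Pair ↔ShrOnly) ↔-refl)
  ; ↔K4Only = ↔Fin-⊎ ↔K4Only (↔Fin-Tor d g)
  ; count-pairs = count-pairs
  ; count-torsion = C.torsion′ count-torsion
  ; count-all = C.all′ count-all }
  where
  open SizedTable S
  module C = ColumnCount #Pair #ShrOnly #K4Only (4 ^ d) (4 ^ g)

sizedTable : ∀ d g → SizedTable d g
sizedTable zero zero = emptySized
sizedTable (suc d) zero = sizedRowStep (sizedTable d zero)
sizedTable d (suc g) = sizedColumnStep (sizedTable d g)

data DoobErr (S K Z : Set) : Set where
  none : DoobErr S K Z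
  shr  : S → Unit6 → DoobErr S K Z
  k4   : K → Fin 3 → DoobErr S K Z
  z4   : Z → Fin 3 → DoobErr S K Z

scalar : Fin 3 → R
scalar ε = fsuc ε , 0F

module _ {d g : ℕ} {S K Z : Set} (colS : S → Syn d g) (colK : K → Tor d g) (colZ : Z → Syn d g) where
  doobSyndrome : DoobErr S K Z → Syn d g
  doobSyndrome none = 0S
  doobSyndrome (shr s u) = unit u · colS s
  doobSyndrome (k4 k i) = emb (ωF^ i ·T colK k)
  doobSyndrome (z4 z ε) = scalar ε · colZ z

record DoobTable (d g : ℕ) (S K Z : Set) : Set where
  field
    colS : S → Syn d g
    colK : K → Tor d g
    colZ : Z → Syn d g
    decode : Syn d g → DoobErr S K Z
    syndrome-decode : ∀ h → doobSyndrome colS colK colZ (decode h) ≡ h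
    decode-syndrome : ∀ e → decode (doobSyndrome colS colK colZ e) ≡ e

signScalar : Bool → Fin 3
signScalar false = 0F
signScalar true = 2F

scalar-sign : ∀ s i → scalar (signScalar s) *R ω^ i ≡ unit (s , i)
scalar-sign = from-yes (∀Bool? λ s → all? λ i → (scalar (signScalar s) *R ω^ i) ≟R unit (s , i))

scalar-two : ∀ i → scalar 1F *R ω^ i ≡ ω^ i *R 2R
scalar-two = from-yes (all? λ i → (scalar 1F *R ω^ i) ≟R (ω^ i *R 2R))

-- Each of
-- the first j pairs (s , k) is replaced by the three ℤ₄-columns ωⁱs: the
-- nine errors ± ωⁱ·s and ωⁱ·k become ε·ωⁱs, since emb k = 2s.
module Trade {d g : ℕ} (D : Table d g) (j r : ℕ) (split : Table.Pair D ↔ (Fin j ⊎ Fin r)) where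
  open Table D
  open TableFacts D
  open Inverse split using (to; from; strictlyInverseˡ; strictlyInverseʳ)

  S' K' Z' : Set
  S' = Fin r ⊎ ShrOnly
  K' = Fin r ⊎ K4Only
  Z' = Fin j × Fin 3

  colS' : S' → Syn d g
  colS' (inj₁ k) = pairS (from (inj₂ k))
  colS' (inj₂ o) = onlyS o

  colK' : K' → Tor d g
  colK' (inj₁ k) = pairK (from (inj₂ k))
  colK' (inj₂ o) = onlyK o

  colZ' : Z' → Syn d g
  colZ' (k , i) = ω^ i · pairS (from (inj₁ k))

  Error' : Set
  Error' = DoobErr S' K' Z'

  σ' : Error' → Syn d g
  σ' = doobSyndrome colS' colK' colZ'

  tradeShr : Fin j ⊎ Fin r → Unit6 → Error'
  tradeShr (inj₁ k) (s , i) = z4 (k , i) (signScalar s)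
  tradeShr (inj₂ k) u = shr (inj₁ k) u

  tradeK4 : Fin j ⊎ Fin r → Fin 3 → Error'
  tradeK4 (inj₁ k) i = z4 (k , i) 1F
  tradeK4 (inj₂ k) i = k4 (inj₁ k) i

  trade : Error → Error'
  trade none = none
  trade (shr (inj₁ c) u) = tradeShr (to c) u
  trade (shr (inj₂ o) u) = shr (inj₂ o) u
  trade (k4 (inj₁ c) i) = tradeK4 (to c) i
  trade (k4 (inj₂ o) i) = k4 (inj₂ o) i

  untrade : Error' → Error
  untrade none = none
  untrade (shr (inj₁ k) u) = shr (inj₁ (from (inj₂ k))) u
  untrade (shr (inj₂ o) u) = shr (inj₂ o) u
  untrade (k4 (inj₁ k) i) = k4 (inj₁ (from (inj₂ k))) i
  untrade (k4 (inj₂ o) i) = k4 (inj₂ o) i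
  untrade (z4 (k , i) 0F) = shr (inj₁ (from (inj₁ k))) (false , i)
  untrade (z4 (k , i) 1F) = k4 (inj₁ (from (inj₁ k))) i
  untrade (z4 (k , i) 2F) = shr (inj₁ (from (inj₁ k))) (true , i)

  trade-untrade : ∀ e → trade (untrade e) ≡ e
  trade-untrade none = refl
  trade-untrade (shr (inj₁ k) u) = cong (λ x → tradeShr x u) (strictlyInverseˡ (inj₂ k))
  trade-untrade (shr (inj₂ o) u) = refl
  trade-untrade (k4 (inj₁ k) i) = cong (λ x → tradeK4 x i) (strictlyInverseˡ (inj₂ k))
  trade-untrade (k4 (inj₂ o) i) = refl
  trade-untrade (z4 (k , i) 0F) = cong (λ x → tradeShr x (false , i)) (strictlyInverseˡ (inj₁ k))
  trade-untrade (z4 (k , i) 1F) = cong (λ x → tradeK4 x i) (strictlyInverseˡ (inj₁ k))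
  trade-untrade (z4 (k , i) 2F) = cong (λ x → tradeShr x (true , i)) (strictlyInverseˡ (inj₁ k))

  untrade-tradeShr : ∀ x u → untrade (tradeShr x u) ≡ shr (inj₁ (from x)) u
  untrade-tradeShr (inj₁ k) (false , i) = refl
  untrade-tradeShr (inj₁ k) (true , i) = refl
  untrade-tradeShr (inj₂ k) u = refl

  untrade-tradeK4 : ∀ x i → untrade (tradeK4 x i) ≡ k4 (inj₁ (from x)) i
  untrade-tradeK4 (inj₁ k) i = refl
  untrade-tradeK4 (inj₂ k) i = refl

  untrade-trade : ∀ e → untrade (trade e) ≡ e
  untrade-trade none = refl
  untrade-trade (shr (inj₁ c) u) = trans (untrade-tradeShr (to c) u) (cong (λ x → shr (inj₁ x) u) (strictlyInverseʳ c))
  untrade-trade (shr (inj₂ o) u) = refl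
  untrade-trade (k4 (inj₁ c) i) = trans (untrade-tradeK4 (to c) i) (cong (λ x → k4 (inj₁ x) i) (strictlyInverseʳ c))
  untrade-trade (k4 (inj₂ o) i) = refl

  sign-column : ∀ s i (h : Syn d g) → scalar (signScalar s) · ω^ i · h ≡ unit (s , i) · h
  sign-column s i h = trans (·-assoc (scalar (signScalar s)) (ω^ i) h) (cong (_· h) (scalar-sign s i))

  σ'-untrade : ∀ e → σ' e ≡ σ (untrade e)
  σ'-untrade none = refl
  σ'-untrade (shr (inj₁ k) u) = refl
  σ'-untrade (shr (inj₂ o) u) = refl
  σ'-untrade (k4 (inj₁ k) i) = refl
  σ'-untrade (k4 (inj₂ o) i) = refl
  σ'-untrade (z4 (k , i) 0F) = sign-column false i (pairS (from (inj₁ k)))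
  σ'-untrade (z4 (k , i) 1F) = two-column i (from (inj₁ k))
    where
    two-column : ∀ i c → scalar 1F · ω^ i · pairS c ≡ emb (ωF^ i ·T pairK c)
    two-column i c = begin
      scalar 1F · ω^ i · pairS c    ≡⟨ ·-assoc (scalar 1F) (ω^ i) (pairS c) ⟩
      (scalar 1F *R ω^ i) · pairS c ≡⟨ cong (_· pairS c) (scalar-two i) ⟩
      (ω^ i *R 2R) · pairS c        ≡⟨ sym (·-assoc (ω^ i) 2R (pairS c)) ⟩
      ω^ i · 2R · pairS c           ≡⟨ cong (ω^ i ·_) (sym (paired c)) ⟩
      ω^ i · emb (pairK c)          ≡⟨ sym (emb-ω i (pairK c)) ⟩
      emb (ωF^ i ·T pairK c)        ∎
  σ'-untrade (z4 (k , i) 2F) = sign-column true i (pairS (from (inj₁ k)))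

  tradedTable : DoobTable d g S' K' Z'
  tradedTable = record
    { colS = colS' ; colK = colK' ; colZ = colZ'
    ; decode = trade ∘ decode
    ; syndrome-decode = λ h →
        trans (σ'-untrade (trade (decode h))) (trans (cong σ (untrade-trade (decode h))) (syndrome-decode h))
    ; decode-syndrome = λ e →
        trans (cong (trade ∘ decode) (σ'-untrade e)) (trans (cong trade (decode-syndrome (untrade e))) (trade-untrade e)) }

mapDoobErr : {S K Z S' K' Z' : Set} → (S → S') → (K → K') → (Z → Z') → DoobErr S K Z → DoobErr S' K' Z'
mapDoobErr f g h none = none
mapDoobErr f g h (shr s u) = shr (f s) u
mapDoobErr f g h (k4 k i) = k4 (g k) i
mapDoobErr f g h (z4 z ε) = z4 (h z) ε

reindex : ∀ {d g} {S K Z S' K' Z' : Set} → S ↔ S' → K ↔ K' → Z ↔ Z' →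
          DoobTable d g S K Z → DoobTable d g S' K' Z'
reindex {d} {g} {S} {K} {Z} {S'} {K'} {Z'} bS bK bZ E = record
  { colS = colS ∘ BS.from ; colK = colK ∘ BK.from ; colZ = colZ ∘ BZ.from
  ; decode = forward ∘ decode
  ; syndrome-decode = λ h → trans (σ'-forward (decode h)) (syndrome-decode h)
  ; decode-syndrome = λ e → trans (cong (forward ∘ decode) (σ'-≡-σ-backward e))
                                  (trans (cong forward (decode-syndrome (backward e))) (forward-backward e)) }
  where
  open DoobTable E
  module BS = Inverse bS
  module BK = Inverse bK
  module BZ = Inverse bZ

  forward : DoobErr S K Z → DoobErr S' K' Z'
  forward = mapDoobErr BS.to BK.to BZ.to

  backward : DoobErr S' K' Z' → DoobErr S K Z
  backward = mapDoobErr BS.from BK.from BZ.from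

  σ' : DoobErr S' K' Z' → Syn d g
  σ' = doobSyndrome (colS ∘ BS.from) (colK ∘ BK.from) (colZ ∘ BZ.from)

  σ'-forward : ∀ e → σ' (forward e) ≡ doobSyndrome colS colK colZ e
  σ'-forward none = refl
  σ'-forward (shr s u) = cong (λ x → unit u · colS x) (BS.strictlyInverseʳ s)
  σ'-forward (k4 k i) = cong (λ x → emb (ωF^ i ·T colK x)) (BK.strictlyInverseʳ k)
  σ'-forward (z4 z ε) = cong (λ x → scalar ε · colZ x) (BZ.strictlyInverseʳ z)

  σ'-≡-σ-backward : ∀ e → σ' e ≡ doobSyndrome colS colK colZ (backward e)
  σ'-≡-σ-backward none = refl
  σ'-≡-σ-backward (shr s u) = refl
  σ'-≡-σ-backward (k4 k i) = refl
  σ'-≡-σ-backward (z4 z ε) = refl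

  forward-backward : ∀ e → forward (backward e) ≡ e
  forward-backward none = refl
  forward-backward (shr s u) = cong (λ x → shr x u) (BS.strictlyInverseˡ s)
  forward-backward (k4 k i) = cong (λ x → k4 x i) (BK.strictlyInverseˡ k)
  forward-backward (z4 z ε) = cong (λ x → z4 x ε) (BZ.strictlyInverseˡ z)

module Cayley {A G : Set} (_-_ : A → A → A) (gens : List A) (gen : G → A)
              (gen∈gens : ∀ γ → gen γ ∈ gens) (gens∋ : ∀ v → v ∈ gens → Σ G λ γ → gen γ ≡ v)
              (-involutive : ∀ q v → q - (q - v) ≡ v) where
  Adj : A → A → Set
  Adj p q = (q - p) ∈ gens

  step : A → G → A
  step q γ = q - gen γ

  adj-step : ∀ q γ → Adj (step q γ) q
  adj-step q γ = subst (_∈ gens) (sym (-involutive q (gen γ))) (gen∈gens γ)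

  adj⇒step : ∀ p q → Adj p q → Σ G λ γ → p ≡ step q γ
  adj⇒step p q pq with gens∋ (q - p) pq
  ... | γ , e = γ , trans (sym (-involutive q p)) (cong (q -_) (sym e))

  move : ∀ {n} → Vec A n → Fin n → G → Vec A n
  move xs i γ = updateAt xs i (λ p → step p γ)

  prodAdj-move : ∀ {n} (xs : Vec A n) i γ → ProdAdj Adj (move xs i γ) xs
  prodAdj-move (x ∷ xs) fzero γ = inj₁ (adj-step x γ , refl)
  prodAdj-move (x ∷ xs) (fsuc i) γ = inj₂ (refl , prodAdj-move xs i γ)

  prodAdj⇒move : ∀ {n} (xs ys : Vec A n) → ProdAdj Adj xs ys → Σ (Fin n × G) λ iγ → xs ≡ move ys (proj₁ iγ) (proj₂ iγ)
  prodAdj⇒move [] [] ()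
  prodAdj⇒move (x ∷ xs) (y ∷ ys) (inj₁ (xy , refl)) with adj⇒step x y xy
  ... | γ , e = (fzero , γ) , cong (_∷ xs) e
  prodAdj⇒move (x ∷ xs) (y ∷ ys) (inj₂ (refl , xsys)) with prodAdj⇒move xs ys xsys
  ... | (i , γ) , e = (fsuc i , γ) , cong (x ∷_) e

module CoordinateSum {d g : ℕ} {A G X : Set} (step : A → G → A)
                     (term : A → X → Syn d g) (err : G → X → Syn d g)
                     (linear : ∀ p γ x → term (step p γ) x +S err γ x ≡ term p x) where
  sumTerms : ∀ {n} → Vec A n → (Fin n → X) → Syn d g
  sumTerms [] cols = 0S
  sumTerms (p ∷ ps) cols = term p (cols fzero) +S sumTerms ps (cols ∘ fsuc)

  sum-move : ∀ {n} (xs : Vec A n) cols i γ →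
             sumTerms (updateAt xs i (λ p → step p γ)) cols +S err γ (cols i) ≡ sumTerms xs cols
  sum-move (x ∷ xs) cols fzero γ = trans (+S-swap _ _ _) (cong (_+S _) (linear x γ (cols fzero)))
  sum-move (x ∷ xs) cols (fsuc i) γ = trans (+S-assoc _ _ _) (cong (_ +S_) (sum-move xs (cols ∘ fsuc) i γ))

infixl 6 _⊖_ _⊖F_

_⊖_ : R → R → R
(a , b) ⊖ (c , d) = sub4 a c , sub4 b d

_⊖F_ : F → F → F
(a , b) ⊖F (c , d) = sub2 a c , sub2 b d

⊖-involutive : ∀ q v → q ⊖ (q ⊖ v) ≡ v
⊖-involutive = from-yes (∀R? λ q → ∀R? λ v → (q ⊖ (q ⊖ v)) ≟R v)

⊖F-involutive : ∀ q v → q ⊖F (q ⊖F v) ≡ v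
⊖F-involutive = from-yes (∀F? λ q → ∀F? λ v → (q ⊖F (q ⊖F v)) ≟F v)

sub4-involutive : ∀ q v → sub4 q (sub4 q v) ≡ v
sub4-involutive = from-yes (all? λ q → all? λ v → sub4 q (sub4 q v) ≟ᶠ v)

⊖-+R : ∀ q v → (q ⊖ v) +R v ≡ q
⊖-+R = from-yes (∀R? λ q → ∀R? λ v → ((q ⊖ v) +R v) ≟R q)

⊖F-+F : ∀ q f → (q ⊖F f) +F f ≡ q
⊖F-+F = from-yes (∀F? λ q → ∀F? λ f → ((q ⊖F f) +F f) ≟F q)

sub4-+R : ∀ q ε → (sub4 q (fsuc ε) , 0F) +R scalar ε ≡ (q , 0F)
sub4-+R = from-yes (all? λ q → all? λ ε → ((sub4 q (fsuc ε) , 0F) +R scalar ε) ≟R (q , 0F))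

unit∈gens : ∀ u → unit u ∈ shrikhandeGens
unit∈gens (false , 1F) = here refl
unit∈gens (true , 0F) = there (here refl)
unit∈gens (false , 2F) = there (there (here refl))
unit∈gens (true , 1F) = there (there (there (here refl)))
unit∈gens (false , 0F) = there (there (there (there (here refl))))
unit∈gens (true , 2F) = there (there (there (there (there (here refl)))))

gens∋unit : ∀ v → v ∈ shrikhandeGens → Σ Unit6 λ u → unit u ≡ v
gens∋unit v (here e) = (false , 1F) , sym e
gens∋unit v (there (here e)) = (true , 0F) , sym e
gens∋unit v (there (there (here e))) = (false , 2F) , sym e
gens∋unit v (there (there (there (here e)))) = (true , 1F) , sym e
gens∋unit v (there (there (there (there (here e))))) = (false , 0F) , sym e
gens∋unit v (there (there (there (there (there (here e)))))) = (true , 2F) , sym e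

ωF∈gens : ∀ i → ωF^ i ∈ k4Gens
ωF∈gens 0F = there (here refl)
ωF∈gens 1F = here refl
ωF∈gens 2F = there (there (here refl))

gens∋ωF : ∀ v → v ∈ k4Gens → Σ (Fin 3) λ i → ωF^ i ≡ v
gens∋ωF v (here e) = 1F , sym e
gens∋ωF v (there (here e)) = 0F , sym e
gens∋ωF v (there (there (here e))) = 2F , sym e

scalar∈gens : ∀ ε → fsuc ε ∈ z4Gens
scalar∈gens 0F = here refl
scalar∈gens 1F = there (here refl)
scalar∈gens 2F = there (there (here refl))

gens∋scalar : ∀ v → v ∈ z4Gens → Σ (Fin 3) λ ε → fsuc ε ≡ v
gens∋scalar v (here e) = 0F , sym e
gens∋scalar v (there (here e)) = 1F , sym e
gens∋scalar v (there (there (here e))) = 2F , sym e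

module ShrGraph = Cayley _⊖_ shrikhandeGens unit unit∈gens gens∋unit ⊖-involutive
module K4Graph  = Cayley _⊖F_ k4Gens ωF^_ ωF∈gens gens∋ωF ⊖F-involutive
module Z4Graph  = Cayley sub4 z4Gens fsuc scalar∈gens gens∋scalar sub4-involutive

-- The code of a perfect Doob table: the vertices of syndrome 0.  The
-- syndrome of a vertex is Σ pᵢ·sᵢ + Σ emb (pⱼ·kⱼ) + Σ pₗ·zₗ over the three
-- kinds of coordinates, and a graph step changes it by exactly one error;
-- so every vertex is within distance 1 of the codeword obtained by
-- removing its decoded error, and of no other.
module DoobCode {d g m n' n'' : ℕ} (E : DoobTable d g (Fin m) (Fin n') (Fin n'')) where
  open DoobTable E

  module ShrSum = CoordinateSum {d} {g} ShrGraph.step (λ p s → p · s) (λ u s → unit u · s)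
    (λ p u s → trans (sym (·-distribʳ (p ⊖ unit u) (unit u) s)) (cong (_· s) (⊖-+R p (unit u))))

  module K4Sum = CoordinateSum {d} {g} K4Graph.step (λ p k → emb (p ·T k)) (λ i k → emb (ωF^ i ·T k))
    (λ p i k → trans (emb-+ _ _) (cong emb (trans (sym (·T-distribʳ (p ⊖F ωF^ i) (ωF^ i) k))
                                                  (cong (_·T k) (⊖F-+F p (ωF^ i))))))

  module Z4Sum = CoordinateSum {d} {g} Z4Graph.step (λ p z → (p , 0F) · z) (λ ε z → scalar ε · z)
    (λ p ε z → trans (sym (·-distribʳ (sub4 p (fsuc ε) , 0F) (scalar ε) z)) (cong (_· z) (sub4-+R p ε)))

  Vertex : Set
  Vertex = DoobVertex m n' n''

  Error : Set
  Error = DoobErr (Fin m) (Fin n') (Fin n'')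

  σ : Error → Syn d g
  σ = doobSyndrome colS colK colZ

  syndromeOf : Vertex → Syn d g
  syndromeOf (a , b , c) = ShrSum.sumTerms a colS +S (K4Sum.sumTerms b colK +S Z4Sum.sumTerms c colZ)

  remove : Vertex → Error → Vertex
  remove x none = x
  remove (a , b , c) (shr i u) = ShrGraph.move a i u , b , c
  remove (a , b , c) (k4 i f) = a , K4Graph.move b i f , c
  remove (a , b , c) (z4 i ε) = a , b , Z4Graph.move c i ε

  syndrome-remove : ∀ x e → syndromeOf (remove x e) +S σ e ≡ syndromeOf x
  syndrome-remove x none = +S-identityʳ (syndromeOf x)
  syndrome-remove (a , b , c) (shr i u) =
    trans (+S-swap (ShrSum.sumTerms (ShrGraph.move a i u) colS) B+C (σ (shr i u)))
          (cong (_+S B+C) (ShrSum.sum-move a colS i u))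
    where
    B+C = K4Sum.sumTerms b colK +S Z4Sum.sumTerms c colZ
  syndrome-remove (a , b , c) (k4 i f) =
    trans (+S-assoc A (B' +S C) (σ (k4 i f)))
          (cong (A +S_) (trans (+S-swap B' C (σ (k4 i f))) (cong (_+S C) (K4Sum.sum-move b colK i f))))
    where
    A = ShrSum.sumTerms a colS
    B' = K4Sum.sumTerms (K4Graph.move b i f) colK
    C = Z4Sum.sumTerms c colZ
  syndrome-remove (a , b , c) (z4 i ε) =
    trans (+S-assoc A (B +S C') (σ (z4 i ε)))
          (cong (A +S_) (trans (+S-assoc B C' (σ (z4 i ε))) (cong (B +S_) (Z4Sum.sum-move c colZ i ε))))
    where
    A = ShrSum.sumTerms a colS
    B = K4Sum.sumTerms b colK
    C' = Z4Sum.sumTerms (Z4Graph.move c i ε) colZ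

  remove-close : ∀ x e → DoobDist≤1 (remove x e) x
  remove-close x none = inj₁ refl
  remove-close (a , b , c) (shr i u) = inj₂ (inj₁ (ShrGraph.prodAdj-move a i u , refl , refl))
  remove-close (a , b , c) (k4 i f) = inj₂ (inj₂ (inj₁ (refl , K4Graph.prodAdj-move b i f , refl)))
  remove-close (a , b , c) (z4 i ε) = inj₂ (inj₂ (inj₂ (refl , refl , Z4Graph.prodAdj-move c i ε)))

  close⇒remove : ∀ y x → DoobDist≤1 y x → Σ Error λ e → y ≡ remove x e
  close⇒remove y x (inj₁ refl) = none , refl
  close⇒remove (a , b , c) (a' , .b , .c) (inj₂ (inj₁ (aa' , refl , refl))) with ShrGraph.prodAdj⇒move a a' aa'
  ... | (i , u) , e = shr i u , cong (_, b , c) e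
  close⇒remove (a , b , c) (.a , b' , .c) (inj₂ (inj₂ (inj₁ (refl , bb' , refl)))) with K4Graph.prodAdj⇒move b b' bb'
  ... | (i , f) , e = k4 i f , cong (λ b'' → a , b'' , c) e
  close⇒remove (a , b , c) (.a , .b , c') (inj₂ (inj₂ (inj₂ (refl , refl , cc')))) with Z4Graph.prodAdj⇒move c c' cc'
  ... | (i , ε) , e = z4 i ε , cong (λ c'' → a , b , c'') e

  code : Vertex → Bool
  code v = isYes (syndromeOf v ≟S 0S)

  code⇒syndrome : ∀ v → code v ≡ true → syndromeOf v ≡ 0S
  code⇒syndrome v eq = toWitness {a? = syndromeOf v ≟S 0S} (Equivalence.from (T-≡ {code v}) eq)

  syndrome⇒code : ∀ v → syndromeOf v ≡ 0S → code v ≡ true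
  syndrome⇒code v eq = Equivalence.to (T-≡ {code v}) (fromWitness {a? = syndromeOf v ≟S 0S} eq)

  codeword-error : ∀ x e → syndromeOf (remove x e) ≡ 0S → σ e ≡ syndromeOf x
  codeword-error x e eq = trans (sym (+S-identityˡ (σ e))) (trans (cong (_+S σ e) (sym eq)) (syndrome-remove x e))

  decoded-codeword : ∀ x → syndromeOf (remove x (decode (syndromeOf x))) ≡ 0S
  decoded-codeword x = +S-cancelʳ (syndromeOf (remove x e)) 0S (syndromeOf x) (begin
    syndromeOf (remove x e) +S syndromeOf x   ≡⟨ cong (syndromeOf (remove x e) +S_) (sym (syndrome-decode (syndromeOf x))) ⟩
    syndromeOf (remove x e) +S σ e            ≡⟨ syndrome-remove x e ⟩
    syndromeOf x                              ≡⟨ sym (+S-identityˡ (syndromeOf x)) ⟩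
    0S +S syndromeOf x                        ∎)
    where
    e = decode (syndromeOf x)

  codeword-near : ∀ x c → code c ≡ true → DoobDist≤1 c x → c ≡ remove x (decode (syndromeOf x))
  codeword-near x c cc cx = near (close⇒remove c x cx)
    where
    near : Σ Error (λ e → c ≡ remove x e) → c ≡ remove x (decode (syndromeOf x))
    near (e , c≡x-e) = trans c≡x-e (cong (remove x) (begin
      e                      ≡⟨ sym (decode-syndrome e) ⟩
      decode (σ e)           ≡⟨ cong decode (codeword-error x e syndrome-0) ⟩
      decode (syndromeOf x)  ∎))
      where
      syndrome-0 : syndromeOf (remove x e) ≡ 0S
      syndrome-0 = trans (cong syndromeOf (sym c≡x-e)) (code⇒syndrome c cc)

  perfect : IsOnePerfectCode m n' n'' code
  perfect = covering , packing
    where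
    covering : ∀ x → Σ Vertex λ c → code c ≡ true × DoobDist≤1 c x
    covering x = remove x e , syndrome⇒code (remove x e) (decoded-codeword x) , remove-close x e
      where
      e = decode (syndromeOf x)

    packing : ∀ x c c' → code c ≡ true → code c' ≡ true → DoobDist≤1 c x → DoobDist≤1 c' x → c ≡ c'
    packing x c c' cc cc' cx c'x = trans (codeword-near x c cc cx) (sym (codeword-near x c' cc' c'x))

doobCode : ∀ {d g m n' n''} → DoobTable d g (Fin m) (Fin n') (Fin n'') → OnePerfectCodeExists m n' n''
doobCode E = DoobCode.code E , DoobCode.perfect E

-- If the Doob parameters satisfy the paper's
-- equations relative to the sizes of a sized table (X = 4^d, Y = 4^g), then
-- exactly j = n''/3 pairs must be traded, and the remaining r pairs together
-- with the unpaired columns account for the m Shrikhande and n' K₄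
-- coordinates.
module FitParameters (m n' n'' nC nS nK X Y : ℕ)
  (#pairs : 1 + 3 * nC ≡ X) (#torsion : 1 + 3 * (nC + nK) ≡ X * Y) (#all : X * Y + 6 * (nC + nS) ≡ X * X * Y)
  (h-all : 3 * (2 * m + n' + n'') + 1 ≡ X * X * Y) (h-k4 : 3 * n' + n'' + 1 ≡ X * Y) (h-z4 : n'' + 1 ≤ X) where

  k4-count : 3 * n' + n'' ≡ 3 * (nC + nK)
  k4-count = +-cancelʳ-≡ 1 _ _ (trans h-k4 (trans (sym #torsion) (+-comm 1 (3 * (nC + nK)))))

  n'≤nC+nK : n' ≤ nC + nK
  n'≤nC+nK = *-cancelˡ-≤ 3 (subst (3 * n' ≤_) k4-count (m≤m+n (3 * n') n''))

  j : ℕ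
  j = (nC + nK) ∸ n'

  n'+j : n' + j ≡ nC + nK
  n'+j = m+[n∸m]≡n n'≤nC+nK

  n''≡3j : n'' ≡ 3 * j
  n''≡3j = +-cancelˡ-≡ (3 * n') _ _ (trans k4-count (trans (cong (3 *_) (sym n'+j)) (*-distribˡ-+ 3 n' j)))

  j≤nC : j ≤ nC
  j≤nC = *-cancelˡ-≤ 3 (+-cancelʳ-≤ 1 _ _
           (subst₂ _≤_ (cong (_+ 1) n''≡3j) (trans (sym #pairs) (+-comm 1 (3 * nC))) h-z4))

  r : ℕ
  r = nC ∸ j

  j+r : j + r ≡ nC
  j+r = m+[n∸m]≡n j≤nC

  m+j : m + j ≡ nC + nS
  m+j = *-cancelˡ-≡ _ _ 6 (+-cancelʳ-≡ (1 + 3 * (nC + nK)) _ _ (begin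
    6 * (m + j) + (1 + 3 * (nC + nK))  ≡⟨ cong (λ b → 6 * (m + j) + (1 + 3 * b)) (sym n'+j) ⟩
    6 * (m + j) + (1 + 3 * (n' + j))   ≡⟨ rearrange m j n' ⟩
    3 * (2 * m + n' + 3 * j) + 1       ≡⟨ cong (λ z → 3 * (2 * m + n' + z) + 1) (sym n''≡3j) ⟩
    3 * (2 * m + n' + n'') + 1         ≡⟨ h-all ⟩
    X * X * Y                          ≡⟨ sym #all ⟩
    X * Y + 6 * (nC + nS)              ≡⟨ cong (_+ 6 * (nC + nS)) (sym #torsion) ⟩
    1 + 3 * (nC + nK) + 6 * (nC + nS)  ≡⟨ +-comm (1 + 3 * (nC + nK)) _ ⟩
    6 * (nC + nS) + (1 + 3 * (nC + nK)) ∎))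
    where
    rearrange : ∀ m j n → 6 * (m + j) + (1 + 3 * (n + j)) ≡ 3 * (2 * m + n + 3 * j) + 1
    rearrange = solve-∀

  cancel-j : ∀ a c → a + j ≡ nC + c → r + c ≡ a
  cancel-j a c e = +-cancelʳ-≡ j _ _ (begin
    r + c + j     ≡⟨ rearrange r c j ⟩
    j + r + c     ≡⟨ cong (_+ c) j+r ⟩
    nC + c        ≡⟨ sym e ⟩
    a + j         ∎)
    where
    rearrange : ∀ r c j → r + c + j ≡ j + r + c
    rearrange = solve-∀

  #Shr : r + nS ≡ m
  #Shr = cancel-j m nS m+j

  #K4 : r + nK ≡ n'
  #K4 = cancel-j n' nK n'+j

  #Z4 : j * 3 ≡ n''
  #Z4 = trans (*-comm j 3) (sym n''≡3j)

fittedTable : ∀ {d g} (S : SizedTable d g) (m n' n'' : ℕ) → let open SizedTable S in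
  3 * (2 * m + n' + n'') + 1 ≡ 4 ^ d * 4 ^ d * 4 ^ g → 3 * n' + n'' + 1 ≡ 4 ^ d * 4 ^ g → n'' + 1 ≤ 4 ^ d →
  DoobTable d g (Fin m) (Fin n') (Fin n'')
fittedTable {d} {g} S m n' n'' h-all h-k4 h-z4 =
  reindex (resize Fit.#Shr (↔Fin-⊎ ↔-refl ↔ShrOnly))
          (resize Fit.#K4 (↔Fin-⊎ ↔-refl ↔K4Only))
          (resize Fit.#Z4 (↔Fin-× ↔-refl ↔-refl))
          (Trade.tradedTable table Fit.j Fit.r split)
  where
  open SizedTable S
  module Fit = FitParameters m n' n'' #Pair #ShrOnly #K4Only (4 ^ d) (4 ^ g)
                 count-pairs count-torsion count-all h-all h-k4 h-z4
  resize : ∀ {A : Set} {a b} → a ≡ b → A ↔ Fin a → A ↔ Fin b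
  resize refl p = p
  split : Table.Pair table ↔ (Fin Fit.j ⊎ Fin Fit.r)
  split = ↔-trans (resize (sym Fit.j+r) ↔Pair) +↔⊎

2^2k : ∀ k → 2 ^ (k * 2) ≡ 4 ^ k
2^2k k = trans (cong (2 ^_) (*-comm k 2)) (sym (^-*-assoc 2 2 k))

-- Sizes of Syn p q and Tor p q as powers of 2 (exponents Γ + 2Δ and Γ + Δ
-- with Γ = 2q, Δ = 2p).
2^-torsion : ∀ p q → 2 ^ (q * 2 + p * 2) ≡ 4 ^ p * 4 ^ q
2^-torsion p q = begin
  2 ^ (q * 2 + p * 2)        ≡⟨ ^-distribˡ-+-* 2 (q * 2) (p * 2) ⟩
  2 ^ (q * 2) * 2 ^ (p * 2)  ≡⟨ cong₂ _*_ (2^2k q) (2^2k p) ⟩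
  4 ^ q * 4 ^ p              ≡⟨ *-comm (4 ^ q) (4 ^ p) ⟩
  4 ^ p * 4 ^ q              ∎

2^-all : ∀ p q → 2 ^ (q * 2 + 2 * (p * 2)) ≡ 4 ^ p * 4 ^ p * 4 ^ q
2^-all p q = begin
  2 ^ (q * 2 + 2 * (p * 2))                  ≡⟨ cong (λ e → 2 ^ (q * 2 + e)) (double (p * 2)) ⟩
  2 ^ (q * 2 + (p * 2 + p * 2))              ≡⟨ ^-distribˡ-+-* 2 (q * 2) (p * 2 + p * 2) ⟩
  2 ^ (q * 2) * 2 ^ (p * 2 + p * 2)          ≡⟨ cong (2 ^ (q * 2) *_) (^-distribˡ-+-* 2 (p * 2) (p * 2)) ⟩
  2 ^ (q * 2) * (2 ^ (p * 2) * 2 ^ (p * 2))  ≡⟨ cong₂ (λ a b → a * (b * b)) (2^2k q) (2^2k p) ⟩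
  4 ^ q * (4 ^ p * 4 ^ p)                    ≡⟨ rotate (4 ^ q) (4 ^ p) ⟩
  4 ^ p * 4 ^ p * 4 ^ q                      ∎
  where
  double : ∀ x → 2 * x ≡ x + x
  double = solve-∀
  rotate : ∀ y x → y * (x * x) ≡ x * x * y
  rotate = solve-∀

corollary3 : (m n' n'' : ℕ) → 1 ≤ m → n'' ≢ 1 →
    Σ ℕ (λ Γ → Σ ℕ (λ Δ → 2 ∣ Γ × 2 ∣ Δ × 2 ≤ Δ
      × 3 * (2 * m + n' + n'') + 1 ≡ 2 ^ (Γ + 2 * Δ)
      × 3 * n' + n'' + 1 ≡ 2 ^ (Γ + Δ)
      × n'' + 1 ≤ 2 ^ Δ)) →
    OnePerfectCodeExists m n' n''
corollary3 m n' n'' _ _ (_ , _ , divides q refl , divides p refl , _ , h-all , h-k4 , h-z4) =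
  doobCode (fittedTable (sizedTable p q) m n' n''
             (trans h-all (2^-all p q)) (trans h-k4 (2^-torsion p q)) (subst (n'' + 1 ≤_) (2^2k p) h-z4))
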